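{- Let $G$ be a connected threshold graph with block sequence $k_1,i_1,\ldots,k_m,i_m,k_{m+1}$, let $k=\sum_{p=1}^{m+1}k_p$, and let $M=M(\alpha_1)$ be the matrix defined in the context. Write $\bar\alpha-\bar\lambda$ for the vector $(b_1-\lambda,\ldots,b_m-\lambda)$, $\bar i=(i_1,\ldots,i_m)$, and for a multi-index $e\in\mathbb{Z}^m$ let $(\bar\alpha-\bar\lambda)^{e}=\prod_{q=1}^m(b_q-\lambda)^{e_q}$. Then if $\alpha_1>0$ is chosen sufficiently large, there exist positive constants $\gamma$ and $c_\epsilon$, for $\epsilon\in\{0,1\}^m$, such that for all $\lambda$ $$\det(M-\lambda I)=(-\lambda)^{k-1}\Big((-\gamma-\lambda)(\bar\alpha-\bar\lambda)^{\bar i}-\sum_{\epsilon\in\{0,1\}^m}c_\epsilon(\bar\alpha-\bar\lambda)^{\bar i-\epsilon}\Big).$$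
   Context: A graph is threshold if it is built from a single vertex by adding vertices one at a time, each new vertex being either a cone (joined to all previous vertices) or an isolate (joined to none); the first vertex counts as a cone. Grouping maximal runs of consecutive cones/isolates, a connected threshold graph has block sequence $k_1,i_1,\ldots,k_m,i_m,k_{m+1}$ (all entries $\geq1$): first $k_1$ cones, then $i_1$ isolates, ..., finally $k_{m+1}$ cones. Call $K_p$ the set of cones of the $p$-th cone block and $I_q$ the set of isolates of the $q$-th isolate block; a cone in $K_p$ and an isolate in $I_q$ are adjacent iff $q<p$. Definition of $M$: for $1\leq q\leq m$ let $\beta_q=k_{q+1}+\cdots+k_{m+1}$ and $b_q=1/\beta_q$; for $1\leq p\leq m+1$ let $a_p=\alpha_1+\sum_{s=p}^{m} i_s b_s$. $M$ is the symmetric matrix indexed by $V(G)$ with: $M_{uv}=-a_{\min(p,p')}$ for $u\in K_p$, $v\in K_{p'}$ (including $u=v$); $M_{uv}=-b_q$ if $u\in K_p$, $v\in I_q$ with $q<p$, and $0$ if $q\geq p$; $M_{uu}=b_q$ for $u\in I_q$; $M_{uv}=0$ for distinct isolates.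
   Formalization: The parameter α₁ and the variable λ are rational, and the constants γ and $c_\epsilon$ are taken in the rationals. -}

module Defs where

open import Data.Nat as ℕ using (ℕ; zero; suc; _∸_)
open import Data.Integer using (+_)
open import Data.Rational using (ℚ; 0ℚ; 1ℚ; _+_; _*_; _-_; -_; _/_)
open import Data.Fin using (Fin; zero; suc; toℕ; fromℕ; inject₁; punchIn; _≟_)
open import Data.Bool using (Bool; true; false; if_then_else_)
open import Data.List using (List; []; _∷_; _++_; replicate; concatMap; allFin; length; lookup)
open import Data.Vec using (Vec; []; _∷_)
open import Relation.Nullary using (yes; no)
open import Relation.Nullary.Decidable using (⌊_⌋)

sumℕ : ∀ {n} → (Fin n → ℕ) → ℕ
sumℕ {zero}  f = 0
sumℕ {suc n} f = f zero ℕ.+ sumℕ (λ j → f (suc j))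

sumℚ : ∀ {n} → (Fin n → ℚ) → ℚ
sumℚ {zero}  f = 0ℚ
sumℚ {suc n} f = f zero + sumℚ (λ j → f (suc j))

-- sum of F ε over all ε ∈ {0,1}^m (ε encoded as Vec Bool m, true = 1)
sumBoolVec : ∀ m → (Vec Bool m → ℚ) → ℚ
sumBoolVec zero    F = F []
sumBoolVec (suc m) F = sumBoolVec m (λ e → F (false ∷ e)) + sumBoolVec m (λ e → F (true ∷ e))

_^ℚ_ : ℚ → ℕ → ℚ
x ^ℚ zero  = 1ℚ
x ^ℚ suc n = x * (x ^ℚ n)

-- 1/n for n ≥ 1 (value at 0 is irrelevant: only used for n ≥ 1)
invℕ : ℕ → ℚ
invℕ zero    = 0ℚ
invℕ (suc n) = + 1 / suc n

bit : Bool → ℕ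
bit true  = 1
bit false = 0

Mat : ℕ → Set
Mat n = Fin n → Fin n → ℚ

sign : ℕ → ℚ
sign zero    = 1ℚ
sign (suc j) = - sign j

det : ∀ n → Mat n → ℚ
det zero    A = 1ℚ
det (suc n) A = sumℚ (λ j → sign (toℕ j) * (A zero j * det n (λ r c → A (suc r) (punchIn j c))))

δ : ∀ {n} → Fin n → Fin n → Bool
δ u v = ⌊ u ≟ v ⌋

shift : ∀ {n} → Mat n → ℚ → Mat n
shift A λ' u v = A u v - (if δ u v then λ' else 0ℚ)

-- Block sequence k₁,i₁,…,k_m,i_m,k_{m+1}, 0-based:
--   k : Fin (suc m) → ℕ  (k p = size of cone block K_{p+1})
--   i : Fin m → ℕ        (i q = size of isolate block I_{q+1})
-- Index orders are preserved by the shift, so "q < p" (1-based) is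
-- toℕ q ℕ.< toℕ p (0-based).

module Block (m : ℕ) (k : Fin (suc m) → ℕ) (i : Fin m → ℕ) where

  ltᵇ : ℕ → ℕ → Bool
  ltᵇ x y = ⌊ x ℕ.<? y ⌋

  leᵇ : ℕ → ℕ → Bool
  leᵇ x y = ⌊ x ℕ.≤? y ⌋

  ktot : ℕ
  ktot = sumℕ k

  β : Fin m → ℕ
  β q = sumℕ (λ p → if ltᵇ (toℕ q) (toℕ p) then k p else 0)

  b : Fin m → ℚ
  b q = invℕ (β q)

  a : ℚ → Fin (suc m) → ℚ
  a α₁ p = α₁ + sumℚ (λ s → if leᵇ (toℕ p) (toℕ s) then (+ (i s) / 1) * b s else 0ℚ)

  data Label : Set where
    cone : Fin (suc m) → Label
    iso  : Fin m → Label

  labels : List Label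
  labels = concatMap (λ q → replicate (k (inject₁ q)) (cone (inject₁ q)) ++ replicate (i q) (iso q)) (allFin m)
           ++ replicate (k (fromℕ m)) (cone (fromℕ m))

  n : ℕ
  n = length labels

  label : Fin n → Label
  label = lookup labels

  entry : ℚ → Label → Label → Bool → ℚ
  entry α₁ (cone p) (cone p') _ = - a α₁ (if leᵇ (toℕ p) (toℕ p') then p else p')
  entry α₁ (cone p) (iso q)   _ = if ltᵇ (toℕ q) (toℕ p) then - b q else 0ℚ
  entry α₁ (iso q)  (cone p)  _ = if ltᵇ (toℕ q) (toℕ p) then - b q else 0ℚ
  entry α₁ (iso q)  (iso q')  same = if same then b q else 0ℚ

  M : ℚ → Mat n
  M α₁ u v = entry α₁ (label u) (label v) (δ u v)

  prodF : ∀ {r} → (Fin r → ℚ) → ℚ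
  prodF {zero}  f = 1ℚ
  prodF {suc r} f = f zero * prodF (λ j → f (suc j))

  prodPow : ℚ → Vec Bool m → ℚ
  prodPow λ' ε = prodF (λ q → (b q - λ') ^ℚ (i q ∸ bit (Data.Vec.lookup ε q)))

  zeros : ∀ {r} → Vec Bool r
  zeros {zero}  = []
  zeros {suc r} = false ∷ zeros

  rhs : ℚ → (Vec Bool m → ℚ) → ℚ → ℚ
  rhs γ c λ' = ((- λ') ^ℚ (ktot ∸ 1))
               * (((- γ) - λ') * prodPow λ' zeros
                  - sumBoolVec m (λ ε → c ε * prodPow λ' ε))

{-# OPTIONS --safe #-}
-- M - λI is a pattern matrix: its entry at (u, v) depends only on the blocks of u and v, apart from the
-- diagonal terms -λ on cones and b_q - λ on isolates.  Subtracting adjacent columns inside a block merges two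
-- of its vertices into one of weight two at the cost of that diagonal term, which produces the factor
-- (-λ)^(k-1) ∏_q (b_q - λ)^(i_q - 1).  Clearing row 0 of the merged first cone block, and then of the merged
-- first isolate block, by column operations and Schur complements leaves matrices of the same kind for the
-- block sequence k₂, i₂, …, with all a_p shifted by a constant.  Since a shift enters affinely, induction gives
--   det (M - λI) = (-λ)^(k-1) ∏_q (b_q - λ)^(i_q - 1) (-λ G(λ) - a₁ W(λ))
-- for polynomials W, G given by a two-term recursion.  In the monomials ∏_q (b_q - λ)^(1 - ε_q) all
-- coefficients of W are positive, so for α₁ large all coefficients of a₁ W + λ (G - ∏_q (b_q - λ)) are
-- positive; half of the one at ε = 0 becomes γ.
module Submission where

open import Defs
open import Data.Bool using (Bool; true; false; if_then_else_; T)
open import Data.Empty using (⊥-elim)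
open import Data.Fin as Fin using (Fin; zero; suc; toℕ; fromℕ; inject₁; punchIn; punchOut; _≟_)
import Data.Fin.Properties as FinP
import Data.Integer as ℤ
import Data.Integer.Properties as ℤP
open import Data.List as List using (List; []; _∷_; _++_; concatMap; length; tabulate)
import Data.List.Properties as ListP
open import Data.Nat as ℕ using (ℕ; zero; suc; _∸_; _≤_)
import Data.Nat.Properties as ℕP
open import Data.Nat.Coprimality as Cop using (1-coprimeTo)
open import Data.Product using (Σ; ∃-syntax; _×_; _,_; proj₁; proj₂)
open import Data.Rational as ℚ using (ℚ; 0ℚ; 1ℚ; _+_; _*_; -_; _-_; _/_; _<_; ½; 1/_; _⊔_; positive; nonNegative)
import Data.Rational.Properties as ℚP
open import Data.Rational.Solver using (module +-*-Solver)
open import Data.Sum using (_⊎_; inj₁; inj₂)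
open import Data.Vec using (Vec; []; _∷_; lookup; replicate)
open import Data.Vec.Functional using () renaming (_∷_ to _◂_)
open import Function using (_∘_)
open import Function.Bundles using (_⇔_; mk⇔)
open import Relation.Binary.Definitions using (tri<; tri≈; tri>)
open import Relation.Binary.PropositionalEquality
open import Relation.Nullary using (Dec; yes; no)
open import Relation.Nullary.Decidable using (⌊_⌋; does-⇔; isYes≗does; dec-true; toWitness)

open +-*-Solver

sumℚ-cong : ∀ {n} {f g : Fin n → ℚ} → (∀ j → f j ≡ g j) → sumℚ f ≡ sumℚ g
sumℚ-cong {zero}  f≗g = refl
sumℚ-cong {suc n} f≗g = cong₂ _+_ (f≗g zero) (sumℚ-cong (f≗g ∘ suc))

sumℚ-zero : ∀ {n} {f : Fin n → ℚ} → (∀ j → f j ≡ 0ℚ) → sumℚ f ≡ 0ℚ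
sumℚ-zero {zero}  f≗0 = refl
sumℚ-zero {suc n} f≗0 = cong₂ _+_ (f≗0 zero) (sumℚ-zero (f≗0 ∘ suc))

sumℚ-linear : ∀ {n} (f g : Fin n → ℚ) x → sumℚ (λ j → f j + x * g j) ≡ sumℚ f + x * sumℚ g
sumℚ-linear {zero}  f g x = solve 1 (λ x → con 0ℚ := con 0ℚ :+ x :* con 0ℚ) refl x
sumℚ-linear {suc n} f g x =
  trans (cong (f zero + x * g zero +_) (sumℚ-linear (f ∘ suc) (g ∘ suc) x))
        (solve 5 (λ a b c d x → (a :+ x :* b) :+ (c :+ x :* d) := (a :+ c) :+ x :* (b :+ d)) refl
               (f zero) (g zero) (sumℚ (f ∘ suc)) (sumℚ (g ∘ suc)) x)

sumℚ-single : ∀ {n} (f : Fin n → ℚ) t → (∀ j → j ≢ t → f j ≡ 0ℚ) → sumℚ f ≡ f t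
sumℚ-single f zero    f≗0 =
  trans (cong (f zero +_) (sumℚ-zero (λ j → f≗0 (suc j) λ ()))) (ℚP.+-identityʳ (f zero))
sumℚ-single f (suc t) f≗0 =
  trans (cong₂ _+_ (f≗0 zero λ ()) (sumℚ-single (f ∘ suc) t (λ j j≢t → f≗0 (suc j) (j≢t ∘ FinP.suc-injective))))
        (ℚP.+-identityˡ (f (suc t)))

sumℚ-pair : ∀ {n} (f : Fin n → ℚ) s t → s ≢ t → (∀ j → j ≢ s → j ≢ t → f j ≡ 0ℚ) → sumℚ f ≡ f s + f t
sumℚ-pair f zero    zero    s≢t f≗0 = ⊥-elim (s≢t refl)
sumℚ-pair f zero    (suc t) s≢t f≗0 =
  cong (f zero +_) (sumℚ-single (f ∘ suc) t (λ j j≢t → f≗0 (suc j) (λ ()) (j≢t ∘ FinP.suc-injective)))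
sumℚ-pair f (suc s) zero    s≢t f≗0 =
  trans (cong (f zero +_) (sumℚ-single (f ∘ suc) s (λ j j≢s → f≗0 (suc j) (j≢s ∘ FinP.suc-injective) (λ ()))))
        (ℚP.+-comm (f zero) (f (suc s)))
sumℚ-pair f (suc s) (suc t) s≢t f≗0 =
  trans (cong₂ _+_ (f≗0 zero (λ ()) (λ ()))
                   (sumℚ-pair (f ∘ suc) s t (s≢t ∘ cong suc)
                              (λ j j≢s j≢t → f≗0 (suc j) (j≢s ∘ FinP.suc-injective) (j≢t ∘ FinP.suc-injective))))
        (ℚP.+-identityˡ _)

minor : ∀ {n} → Mat (suc n) → Fin (suc n) → Mat n
minor A j r c = A (suc r) (punchIn j c)

laplaceTerm : ∀ {n} → Mat (suc n) → Fin (suc n) → ℚ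
laplaceTerm {n} A j = sign (toℕ j) * (A zero j * det n (minor A j))

det-cong : ∀ n {A B : Mat n} → (∀ r c → A r c ≡ B r c) → det n A ≡ det n B
det-cong zero    A≗B = refl
det-cong (suc n) A≗B = sumℚ-cong λ j →
  cong₂ (λ x y → sign (toℕ j) * (x * y)) (A≗B zero j) (det-cong n (λ r c → A≗B (suc r) (punchIn j c)))

laplaceTerm-linear : ∀ {n} (A B C : Mat (suc n)) x j →
  C zero j ≡ A zero j + x * B zero j →
  (∀ r c → minor A j r c ≡ minor C j r c) → (∀ r c → minor B j r c ≡ minor C j r c) →
  laplaceTerm C j ≡ laplaceTerm A j + x * laplaceTerm B j
laplaceTerm-linear {n} A B C x j C₀ⱼ A≗C B≗C = begin
  sign (toℕ j) * (C zero j * det n (minor C j))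
    ≡⟨ cong₂ (λ y z → sign (toℕ j) * (y * z)) C₀ⱼ (sym (det-cong n A≗C)) ⟩
  sign (toℕ j) * ((A zero j + x * B zero j) * det n (minor A j))
    ≡⟨ solve 5 (λ σ a b d x → σ :* ((a :+ x :* b) :* d) := σ :* (a :* d) :+ x :* (σ :* (b :* d))) refl
             (sign (toℕ j)) (A zero j) (B zero j) (det n (minor A j)) x ⟩
  laplaceTerm A j + x * (sign (toℕ j) * (B zero j * det n (minor A j)))
    ≡⟨ cong (λ d → laplaceTerm A j + x * (sign (toℕ j) * (B zero j * d)))
            (det-cong n (λ r c → trans (A≗C r c) (sym (B≗C r c)))) ⟩
  laplaceTerm A j + x * laplaceTerm B j ∎
  where open ≡-Reasoning

laplaceTerm-linear-minor : ∀ {n} (A B C : Mat (suc n)) x j →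
  A zero j ≡ C zero j → B zero j ≡ C zero j →
  det n (minor C j) ≡ det n (minor A j) + x * det n (minor B j) →
  laplaceTerm C j ≡ laplaceTerm A j + x * laplaceTerm B j
laplaceTerm-linear-minor {n} A B C x j A₀ⱼ B₀ⱼ minorC = begin
  sign (toℕ j) * (C zero j * det n (minor C j))
    ≡⟨ cong (λ d → sign (toℕ j) * (C zero j * d)) minorC ⟩
  sign (toℕ j) * (C zero j * (det n (minor A j) + x * det n (minor B j)))
    ≡⟨ solve 5 (λ σ c a b x → σ :* (c :* (a :+ x :* b)) := σ :* (c :* a) :+ x :* (σ :* (c :* b))) refl
             (sign (toℕ j)) (C zero j) (det n (minor A j)) (det n (minor B j)) x ⟩
  sign (toℕ j) * (C zero j * det n (minor A j)) + x * (sign (toℕ j) * (C zero j * det n (minor B j)))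
    ≡⟨ cong₂ (λ a b → sign (toℕ j) * (a * det n (minor A j)) + x * (sign (toℕ j) * (b * det n (minor B j))))
             (sym A₀ⱼ) (sym B₀ⱼ) ⟩
  laplaceTerm A j + x * laplaceTerm B j ∎
  where open ≡-Reasoning

det-linear-row₀ : ∀ n (A B C : Mat (suc n)) x →
  (∀ r c → A (suc r) c ≡ C (suc r) c) → (∀ r c → B (suc r) c ≡ C (suc r) c) →
  (∀ c → C zero c ≡ A zero c + x * B zero c) →
  det (suc n) C ≡ det (suc n) A + x * det (suc n) B
det-linear-row₀ n A B C x A≗C B≗C row₀ =
  trans (sumℚ-cong (λ j → laplaceTerm-linear A B C x j (row₀ j) (λ r c → A≗C r _) (λ r c → B≗C r _)))
        (sumℚ-linear (laplaceTerm A) (laplaceTerm B) x)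

det-corner : ∀ n (A : Mat (suc n)) → (∀ c → A zero (suc c) ≡ 0ℚ) →
  det (suc n) A ≡ A zero zero * det n (λ r c → A (suc r) (suc c))
det-corner n A row₀ = trans (sumℚ-single (laplaceTerm A) zero vanish) (ℚP.*-identityˡ _)
  where
  vanish : ∀ j → j ≢ zero → laplaceTerm A j ≡ 0ℚ
  vanish zero    j≢0 = ⊥-elim (j≢0 refl)
  vanish (suc j) _ =
    trans (cong (λ a → sign (toℕ (suc j)) * (a * det n (minor A (suc j)))) (row₀ j))
          (solve 2 (λ σ d → σ :* (con 0ℚ :* d) := con 0ℚ) refl (sign (toℕ (suc j))) (det n (minor A (suc j))))

det-linear-col : ∀ n t (A B C : Mat n) x →
  (∀ r c → c ≢ t → A r c ≡ C r c) → (∀ r c → c ≢ t → B r c ≡ C r c) →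
  (∀ r → C r t ≡ A r t + x * B r t) → det n C ≡ det n A + x * det n B
det-linear-col (suc n) t A B C x A≗C B≗C colₜ =
  trans (sumℚ-cong term) (sumℚ-linear (laplaceTerm A) (laplaceTerm B) x)
  where
  term : ∀ j → laplaceTerm C j ≡ laplaceTerm A j + x * laplaceTerm B j
  term j with j ≟ t
  ... | yes refl = laplaceTerm-linear A B C x j (colₜ zero)
                     (λ r c → A≗C (suc r) _ (FinP.punchInᵢ≢i j c)) (λ r c → B≗C (suc r) _ (FinP.punchInᵢ≢i j c))
  ... | no j≢t = laplaceTerm-linear-minor A B C x j (A≗C zero j j≢t) (B≗C zero j j≢t)
                   (det-linear-col n t′ (minor A j) (minor B j) (minor C j) x
                      (λ r c c≢t′ → A≗C (suc r) _ (avoids c c≢t′)) (λ r c c≢t′ → B≗C (suc r) _ (avoids c c≢t′))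
                      (λ r → trans (cong (C (suc r)) punchIn-t′) (trans (colₜ (suc r))
                               (cong₂ (λ c c′ → A (suc r) c + x * B (suc r) c′) (sym punchIn-t′) (sym punchIn-t′)))))
    where
    t′ = punchOut j≢t
    punchIn-t′ : punchIn j t′ ≡ t
    punchIn-t′ = FinP.punchIn-punchOut j≢t
    avoids : ∀ c → c ≢ t′ → punchIn j c ≢ t
    avoids c c≢t′ eq = c≢t′ (FinP.punchIn-injective j c t′ (trans eq (sym punchIn-t′)))

punchOut-adjacent : ∀ {n} {j s t : Fin (suc n)} (j≢s : j ≢ s) (j≢t : j ≢ t) →
  toℕ t ≡ suc (toℕ s) → toℕ (punchOut j≢t) ≡ suc (toℕ (punchOut j≢s))
punchOut-adjacent {n}           {zero}        {zero}  {t}           j≢s j≢t eq = ⊥-elim (j≢s refl)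
punchOut-adjacent {n}           {zero}        {suc s} {zero}        j≢s j≢t ()
punchOut-adjacent {n}           {zero}        {suc s} {suc t}       j≢s j≢t eq = ℕP.suc-injective eq
punchOut-adjacent {suc n}       {suc j}       {zero}  {zero}        j≢s j≢t ()
punchOut-adjacent {suc n}       {suc zero}    {zero}  {suc zero}    j≢s j≢t eq = ⊥-elim (j≢t refl)
punchOut-adjacent {suc (suc n)} {suc (suc j)} {zero}  {suc zero}    j≢s j≢t eq = refl
punchOut-adjacent {suc n}       {suc j}       {zero}  {suc (suc t)} j≢s j≢t ()
punchOut-adjacent {suc n}       {suc j}       {suc s} {zero}        j≢s j≢t ()
punchOut-adjacent {suc n}       {suc j}       {suc s} {suc t}       j≢s j≢t eq =
  cong suc (punchOut-adjacent (j≢s ∘ cong suc) (j≢t ∘ cong suc) (ℕP.suc-injective eq))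

punchIn-adjacent : ∀ {n} {s t : Fin (suc n)} → toℕ t ≡ suc (toℕ s) → ∀ c →
  (punchIn s c ≡ punchIn t c) ⊎ (punchIn s c ≡ t × punchIn t c ≡ s)
punchIn-adjacent {n}     {zero}  {zero}        ()
punchIn-adjacent {n}     {zero}  {suc zero}    eq zero    = inj₂ (refl , refl)
punchIn-adjacent {n}     {zero}  {suc zero}    eq (suc c) = inj₁ refl
punchIn-adjacent {n}     {zero}  {suc (suc t)} ()
punchIn-adjacent {n}     {suc s} {zero}        ()
punchIn-adjacent {suc n} {suc s} {suc t}       eq zero    = inj₁ refl
punchIn-adjacent {suc n} {suc s} {suc t}       eq (suc c) with punchIn-adjacent {n} {s} {t} (ℕP.suc-injective eq) c
... | inj₁ same          = inj₁ (cong suc same)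
... | inj₂ (to-t , to-s) = inj₂ (cong suc to-t , cong suc to-s)

adjacent⇒≢ : ∀ {n} {s t : Fin n} → toℕ t ≡ suc (toℕ s) → s ≢ t
adjacent⇒≢ eq refl = ℕP.1+n≢n (sym eq)

-- Laplace terms at j ∉ {s, t} vanish by induction; those at s and t cancel, with equal minors and opposite signs.
det-adjacent-equal-cols : ∀ n (s t : Fin n) (A : Mat n) → toℕ t ≡ suc (toℕ s) →
  (∀ r → A r s ≡ A r t) → det n A ≡ 0ℚ
det-adjacent-equal-cols (suc n) s t A adj colₛ≡colₜ =
  trans (sumℚ-pair (laplaceTerm A) s t (adjacent⇒≢ adj) others) cancel
  where
  others : ∀ j → j ≢ s → j ≢ t → laplaceTerm A j ≡ 0ℚ
  others j j≢s j≢t =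
    trans (cong (λ d → sign (toℕ j) * (A zero j * d))
                (det-adjacent-equal-cols n (punchOut j≢s) (punchOut j≢t) (minor A j) (punchOut-adjacent j≢s j≢t adj)
                   (λ r → trans (cong (A (suc r)) (FinP.punchIn-punchOut j≢s))
                                (trans (colₛ≡colₜ (suc r)) (cong (A (suc r)) (sym (FinP.punchIn-punchOut j≢t)))))))
          (solve 2 (λ σ a → σ :* (a :* con 0ℚ) := con 0ℚ) refl (sign (toℕ j)) (A zero j))
  same-minor : ∀ r c → minor A s r c ≡ minor A t r c
  same-minor r c with punchIn-adjacent adj c
  ... | inj₁ same          = cong (A (suc r)) same
  ... | inj₂ (to-t , to-s) = trans (cong (A (suc r)) to-t) (trans (sym (colₛ≡colₜ (suc r))) (cong (A (suc r)) (sym to-s)))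
  cancel : laplaceTerm A s + laplaceTerm A t ≡ 0ℚ
  cancel = begin
    sign (toℕ s) * (A zero s * det n (minor A s)) + sign (toℕ t) * (A zero t * det n (minor A t))
      ≡⟨ cong₂ (λ a σ → sign (toℕ s) * (a * det n (minor A s)) + σ * (A zero t * det n (minor A t)))
               (colₛ≡colₜ zero) (cong sign adj) ⟩
    sign (toℕ s) * (A zero t * det n (minor A s)) + - sign (toℕ s) * (A zero t * det n (minor A t))
      ≡⟨ cong (λ d → sign (toℕ s) * (A zero t * d) + - sign (toℕ s) * (A zero t * det n (minor A t)))
              (det-cong n same-minor) ⟩
    sign (toℕ s) * (A zero t * det n (minor A t)) + - sign (toℕ s) * (A zero t * det n (minor A t))
      ≡⟨ solve 2 (λ σ x → σ :* x :+ (:- σ) :* x := con 0ℚ) refl (sign (toℕ s)) (A zero t * det n (minor A t)) ⟩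
    0ℚ ∎
    where open ≡-Reasoning

setCol : ∀ {n} → Mat n → Fin n → (Fin n → ℚ) → Mat n
setCol A t u r c = if ⌊ c ≟ t ⌋ then u r else A r c

setCol-same : ∀ {n} (A : Mat n) t u r → setCol A t u r t ≡ u r
setCol-same A t u r with t ≟ t
... | yes _   = refl
... | no t≢t = ⊥-elim (t≢t refl)

setCol-other : ∀ {n} (A : Mat n) t u r c → c ≢ t → setCol A t u r c ≡ A r c
setCol-other A t u r c c≢t with c ≟ t
... | yes c≡t = ⊥-elim (c≢t c≡t)
... | no _    = refl

swapCols : ∀ {n} → Mat n → Fin n → Fin n → Mat n
swapCols A s t = setCol (setCol A s (λ r → A r t)) t (λ r → A r s)

-- With B u v = A with columns s, t replaced by u, v: det (B u v) is bilinear and alternating,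
-- so 0 = det (B (a + b) (a + b)) = det (B a b) + det (B b a).
det-swap-adjacent-cols : ∀ n (s t : Fin n) (A : Mat n) → toℕ t ≡ suc (toℕ s) →
  det n (swapCols A s t) ≡ - det n A
det-swap-adjacent-cols n s t A adj = begin
  det n (B b a)                                  ≡⟨ solve 2 (λ x y → y := x :+ y :- x) refl (det n (B a b)) (det n (B b a)) ⟩
  det n (B a b) + det n (B b a) - det n (B a b)  ≡⟨ cong (_- det n (B a b)) (sym antisymmetric) ⟩
  0ℚ - det n (B a b)                             ≡⟨ ℚP.+-identityˡ _ ⟩
  - det n (B a b)                                ≡⟨ cong -_ (det-cong n B-ab) ⟩
  - det n A                                      ∎
  where
  open ≡-Reasoning
  s≢t = adjacent⇒≢ adj
  a b : Fin n → ℚ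
  a r = A r s
  b r = A r t
  B : (Fin n → ℚ) → (Fin n → ℚ) → Mat n
  B u v = setCol (setCol A s u) t v
  B-s : ∀ u v r → B u v r s ≡ u r
  B-s u v r = trans (setCol-other (setCol A s u) t v r s s≢t) (setCol-same A s u r)
  B-t : ∀ u v r → B u v r t ≡ v r
  B-t u v r = setCol-same (setCol A s u) t v r
  B-offˢ : ∀ u u′ v r c → c ≢ s → B u v r c ≡ B u′ v r c
  B-offˢ u u′ v r c c≢s with c ≟ t
  ... | yes _ = refl
  ... | no _  = trans (setCol-other A s u r c c≢s) (sym (setCol-other A s u′ r c c≢s))
  B-offᵗ : ∀ u v v′ r c → c ≢ t → B u v r c ≡ B u v′ r c
  B-offᵗ u v v′ r c c≢t with c ≟ t
  ... | yes c≡t = ⊥-elim (c≢t c≡t)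
  ... | no _    = refl
  B-ab : ∀ r c → B a b r c ≡ A r c
  B-ab r c with c ≟ t
  ... | yes refl = refl
  ... | no _ with c ≟ s
  ...   | yes refl = refl
  ...   | no _     = refl
  _⊕_ : (Fin n → ℚ) → (Fin n → ℚ) → Fin n → ℚ
  (u ⊕ u′) r = u r + 1ℚ * u′ r
  additiveˢ : ∀ u u′ v → det n (B (u ⊕ u′) v) ≡ det n (B u v) + 1ℚ * det n (B u′ v)
  additiveˢ u u′ v = det-linear-col n s (B u v) (B u′ v) (B (u ⊕ u′) v) 1ℚ
    (λ r c c≢s → B-offˢ u (u ⊕ u′) v r c c≢s) (λ r c c≢s → B-offˢ u′ (u ⊕ u′) v r c c≢s)
    (λ r → trans (B-s (u ⊕ u′) v r) (cong₂ (λ x y → x + 1ℚ * y) (sym (B-s u v r)) (sym (B-s u′ v r))))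
  additiveᵗ : ∀ u v v′ → det n (B u (v ⊕ v′)) ≡ det n (B u v) + 1ℚ * det n (B u v′)
  additiveᵗ u v v′ = det-linear-col n t (B u v) (B u v′) (B u (v ⊕ v′)) 1ℚ
    (λ r c c≢t → B-offᵗ u v (v ⊕ v′) r c c≢t) (λ r c c≢t → B-offᵗ u v′ (v ⊕ v′) r c c≢t)
    (λ r → trans (B-t u (v ⊕ v′) r) (cong₂ (λ x y → x + 1ℚ * y) (sym (B-t u v r)) (sym (B-t u v′ r))))
  alternating : ∀ u → det n (B u u) ≡ 0ℚ
  alternating u = det-adjacent-equal-cols n s t (B u u) adj (λ r → trans (B-s u u r) (sym (B-t u u r)))
  antisymmetric : 0ℚ ≡ det n (B a b) + det n (B b a)
  antisymmetric = begin
    0ℚ                                                                   ≡⟨ sym (alternating (a ⊕ b)) ⟩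
    det n (B (a ⊕ b) (a ⊕ b))                                             ≡⟨ additiveˢ a b (a ⊕ b) ⟩
    det n (B a (a ⊕ b)) + 1ℚ * det n (B b (a ⊕ b))
      ≡⟨ cong₂ (λ x y → x + 1ℚ * y) (additiveᵗ a a b) (additiveᵗ b a b) ⟩
    (det n (B a a) + 1ℚ * det n (B a b)) + 1ℚ * (det n (B b a) + 1ℚ * det n (B b b))
      ≡⟨ cong₂ (λ x y → (x + 1ℚ * det n (B a b)) + 1ℚ * (det n (B b a) + 1ℚ * y)) (alternating a) (alternating b) ⟩
    (0ℚ + 1ℚ * det n (B a b)) + 1ℚ * (det n (B b a) + 1ℚ * 0ℚ)
      ≡⟨ solve 2 (λ x y → (con 0ℚ :+ con 1ℚ :* x) :+ con 1ℚ :* (y :+ con 1ℚ :* con 0ℚ) := x :+ y) refl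
               (det n (B a b)) (det n (B b a)) ⟩
    det n (B a b) + det n (B b a)                                         ∎

det-equal-cols-at-distance : ∀ n d (s t : Fin n) (A : Mat n) → suc (toℕ s) ℕ.+ d ≡ toℕ t →
  (∀ r → A r s ≡ A r t) → det n A ≡ 0ℚ
det-equal-cols-at-distance n zero s t A dist colₛ≡colₜ =
  det-adjacent-equal-cols n s t A (trans (sym dist) (cong suc (ℕP.+-identityʳ (toℕ s)))) colₛ≡colₜ
det-equal-cols-at-distance (suc n) (suc d) s (suc t) A dist colₛ≡colₜ = begin
  det (suc n) A           ≡⟨ solve 1 (λ x → x := :- (:- x)) refl (det (suc n) A) ⟩
  - - det (suc n) A       ≡⟨ cong -_ (sym (det-swap-adjacent-cols (suc n) u (suc t) A adj)) ⟩
  - det (suc n) A′        ≡⟨ cong -_ (det-equal-cols-at-distance (suc n) d s u A′ dist′ A′ₛ≡A′ᵤ) ⟩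
  - 0ℚ                    ≡⟨⟩
  0ℚ                      ∎
  where
  open ≡-Reasoning
  u = inject₁ t
  A₁ = setCol A u (λ r → A r (suc t))
  A′ = swapCols A u (suc t)
  adj : toℕ (suc t) ≡ suc (toℕ u)
  adj = cong suc (sym (FinP.toℕ-inject₁ t))
  dist′ : suc (toℕ s) ℕ.+ d ≡ toℕ u
  dist′ = trans (sym (ℕP.+-suc (toℕ s) d)) (trans (ℕP.suc-injective dist) (sym (FinP.toℕ-inject₁ t)))
  far : ∀ {c} e → suc (toℕ s) ℕ.+ e ≡ toℕ c → s ≢ c
  far e eq refl = ℕP.m≢1+m+n (toℕ s) (sym eq)
  A′ₛ≡A′ᵤ : ∀ r → A′ r s ≡ A′ r u
  A′ₛ≡A′ᵤ r = begin
    A′ r s        ≡⟨ setCol-other A₁ (suc t) (λ r → A r u) r s (far (suc d) dist) ⟩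
    A₁ r s        ≡⟨ setCol-other A u (λ r → A r (suc t)) r s (far d dist′) ⟩
    A r s         ≡⟨ colₛ≡colₜ r ⟩
    A r (suc t)   ≡⟨ sym (setCol-same A u (λ r → A r (suc t)) r) ⟩
    A₁ r u        ≡⟨ sym (setCol-other A₁ (suc t) (λ r → A r u) r u (adjacent⇒≢ adj)) ⟩
    A′ r u        ∎

det-equal-cols : ∀ n (s t : Fin n) (A : Mat n) → s ≢ t → (∀ r → A r s ≡ A r t) → det n A ≡ 0ℚ
det-equal-cols n s t A s≢t colₛ≡colₜ with FinP.<-cmp s t
... | tri< s<t _ _ = det-equal-cols-at-distance n _ s t A (proj₂ (ℕP.m≤n⇒∃[o]m+o≡n s<t)) colₛ≡colₜ
... | tri≈ _ s≡t _ = ⊥-elim (s≢t s≡t)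
... | tri> _ _ t<s = det-equal-cols-at-distance n _ t s A (proj₂ (ℕP.m≤n⇒∃[o]m+o≡n t<s)) (sym ∘ colₛ≡colₜ)

det-add-col-multiple : ∀ n (s t : Fin n) (A A′ : Mat n) x → s ≢ t →
  (∀ r c → c ≢ t → A′ r c ≡ A r c) → (∀ r → A′ r t ≡ A r t + x * A r s) → det n A′ ≡ det n A
det-add-col-multiple n s t A A′ x s≢t A′≗A colₜ = begin
  det n A′                  ≡⟨ det-linear-col n t A B A′ x (λ r c c≢t → sym (A′≗A r c c≢t))
                                 (λ r c c≢t → trans (setCol-other A t colₛ r c c≢t) (sym (A′≗A r c c≢t)))
                                 (λ r → trans (colₜ r) (cong (λ y → A r t + x * y) (sym (setCol-same A t colₛ r)))) ⟩
  det n A + x * det n B     ≡⟨ cong (λ d → det n A + x * d) B-singular ⟩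
  det n A + x * 0ℚ          ≡⟨ solve 2 (λ d x → d :+ x :* con 0ℚ := d) refl (det n A) x ⟩
  det n A                   ∎
  where
  open ≡-Reasoning
  colₛ = λ r → A r s
  B = setCol A t colₛ
  B-singular : det n B ≡ 0ℚ
  B-singular = det-equal-cols n s t B s≢t (λ r → trans (setCol-other A t colₛ r s s≢t) (sym (setCol-same A t colₛ r)))

addCol₀Multiples : ∀ {n} → Mat (suc n) → (Fin n → ℚ) → ℕ → Mat (suc n)
addCol₀Multiples A g j r zero    = A r zero
addCol₀Multiples A g j r (suc c) = if ⌊ toℕ c ℕ.<? j ⌋ then A r (suc c) + g c * A r zero else A r (suc c)

det-addCol₀Multiples : ∀ n (A : Mat (suc n)) g j → j ≤ n → det (suc n) (addCol₀Multiples A g j) ≡ det (suc n) A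
det-addCol₀Multiples n A g zero    _   = det-cong (suc n) unchanged
  where
  unchanged : ∀ r c → addCol₀Multiples A g zero r c ≡ A r c
  unchanged r zero    = refl
  unchanged r (suc c) = refl
det-addCol₀Multiples n A g (suc j) j<n =
  trans (det-add-col-multiple (suc n) zero (suc c) (addCol₀Multiples A g j) (addCol₀Multiples A g (suc j)) (g c) (λ ())
           others column-c)
        (det-addCol₀Multiples n A g j (ℕP.<⇒≤ j<n))
  where
  c = Fin.fromℕ< j<n
  toℕ-c : toℕ c ≡ j
  toℕ-c = FinP.toℕ-fromℕ< j<n
  others : ∀ r c′ → c′ ≢ suc c → addCol₀Multiples A g (suc j) r c′ ≡ addCol₀Multiples A g j r c′
  others r zero     _       = refl
  others r (suc c′) c′≢c with toℕ c′ ℕ.<? suc j | toℕ c′ ℕ.<? j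
  ... | yes _    | yes _   = refl
  ... | no _     | no _    = refl
  ... | yes c′≤j | no c′≮j = ⊥-elim (c′≢c (cong suc (FinP.toℕ-injective
                               (trans (ℕP.≤-antisym (ℕP.≤-pred c′≤j) (ℕP.≮⇒≥ c′≮j)) (sym toℕ-c)))))
  ... | no c′≮1+j | yes c′<j = ⊥-elim (c′≮1+j (ℕP.m<n⇒m<1+n c′<j))
  column-c : ∀ r → addCol₀Multiples A g (suc j) r (suc c) ≡ addCol₀Multiples A g j r (suc c) + g c * A r zero
  column-c r with toℕ c ℕ.<? suc j | toℕ c ℕ.<? j
  ... | yes _    | no _    = refl
  ... | no c≮1+j | _       = ⊥-elim (c≮1+j (ℕP.≤-reflexive (cong suc toℕ-c)))
  ... | yes _    | yes c<j = ⊥-elim (ℕP.<-irrefl toℕ-c c<j)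

det-add-col₀-multiples : ∀ n (A A′ : Mat (suc n)) (g : Fin n → ℚ) → (∀ r → A′ r zero ≡ A r zero) →
  (∀ r c → A′ r (suc c) ≡ A r (suc c) + g c * A r zero) → det (suc n) A′ ≡ det (suc n) A
det-add-col₀-multiples n A A′ g col₀ cols =
  trans (det-cong (suc n) all-added) (det-addCol₀Multiples n A g n ℕP.≤-refl)
  where
  all-added : ∀ r c → A′ r c ≡ addCol₀Multiples A g n r c
  all-added r zero    = col₀ r
  all-added r (suc c) with toℕ c ℕ.<? n
  ... | yes _   = cols r c
  ... | no c≮n = ⊥-elim (c≮n (FinP.toℕ<n c))

det-zero-col : ∀ n t (A : Mat n) → (∀ r → A r t ≡ 0ℚ) → det n A ≡ 0ℚ
det-zero-col n t A colₜ = begin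
  det n A                               ≡⟨ solve 1 (λ d → d := (d :+ con 1ℚ :* d) :- d) refl (det n A) ⟩
  (det n A + 1ℚ * det n A) - det n A    ≡⟨ cong (_- det n A) (sym doubled) ⟩
  det n A - det n A                     ≡⟨ ℚP.+-inverseʳ (det n A) ⟩
  0ℚ                                    ∎
  where
  open ≡-Reasoning
  doubled : det n A ≡ det n A + 1ℚ * det n A
  doubled = det-linear-col n t A A A 1ℚ (λ _ _ _ → refl) (λ _ _ _ → refl)
    (λ r → trans (colₜ r) (trans (solve 0 (con 0ℚ := con 0ℚ :+ con 1ℚ :* con 0ℚ) refl)
                                 (cong₂ (λ x y → x + 1ℚ * y) (sym (colₜ r)) (sym (colₜ r)))))

det-scale-col : ∀ n t (A A′ : Mat n) x → (∀ r c → c ≢ t → A r c ≡ A′ r c) →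
  (∀ r → A′ r t ≡ x * A r t) → det n A′ ≡ x * det n A
det-scale-col n t A A′ x A≗A′ colₜ = begin
  det n A′
    ≡⟨ det-linear-col n t Z A A′ x (λ r c c≢t → trans (setCol-other A t zeros r c c≢t) (A≗A′ r c c≢t)) A≗A′
         (λ r → trans (colₜ r) (trans (sym (ℚP.+-identityˡ _)) (cong (_+ x * A r t) (sym (setCol-same A t zeros r))))) ⟩
  det n Z + x * det n A     ≡⟨ cong (_+ x * det n A) (det-zero-col n t Z (setCol-same A t zeros)) ⟩
  0ℚ + x * det n A          ≡⟨ ℚP.+-identityˡ _ ⟩
  x * det n A               ∎
  where
  open ≡-Reasoning
  zeros : Fin n → ℚ
  zeros _ = 0ℚ
  Z = setCol A t zeros

bordered : ∀ {n} → ℚ → (Fin n → ℚ) → (Fin n → ℚ) → Mat n → Mat (suc n)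
bordered d u v C zero    zero    = d
bordered d u v C zero    (suc c) = u c
bordered d u v C (suc r) zero    = v r
bordered d u v C (suc r) (suc c) = C r c

det-bordered : ∀ n d (u v : Fin n → ℚ) (C : Mat n) →
  det (suc n) (bordered d (λ c → d * u c) v C) ≡ d * det n (λ r c → C r c - v r * u c)
det-bordered n d u v C = begin
  det (suc n) (bordered d (λ c → d * u c) v C)
    ≡⟨ sym (det-add-col₀-multiples n (bordered d (λ c → d * u c) v C) B (λ c → - u c) (λ r → refl) (λ r c → refl)) ⟩
  det (suc n) B
    ≡⟨ det-corner n B (λ c → solve 2 (λ d u → d :* u :+ (:- u) :* d := con 0ℚ) refl d (u c)) ⟩
  d * det n (λ r c → B (suc r) (suc c))
    ≡⟨ cong (d *_) (det-cong n (λ r c → solve 3 (λ x u v → x :+ (:- u) :* v := x :- v :* u) refl (C r c) (u c) (v r))) ⟩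
  d * det n (λ r c → C r c - v r * u c) ∎
  where
  open ≡-Reasoning
  B : Mat (suc n)
  B r zero    = bordered d (λ c → d * u c) v C r zero
  B r (suc c) = bordered d (λ c → d * u c) v C r (suc c) + - u c * bordered d (λ c → d * u c) v C r zero

det-bordered-split : ∀ n e x d (u v : Fin n → ℚ) (C : Mat n) →
  det (suc n) (bordered (e + x * d) (λ c → x * u c) v C) ≡ e * det n C + x * det (suc n) (bordered d u v C)
det-bordered-split n e x d u v C = begin
  det (suc n) (bordered (e + x * d) (λ c → x * u c) v C)
    ≡⟨ det-linear-row₀ n (bordered e (λ _ → 0ℚ) v C) (bordered d u v C) (bordered (e + x * d) (λ c → x * u c) v C) x
                        same-below same-below row₀ ⟩
  det (suc n) (bordered e (λ _ → 0ℚ) v C) + x * det (suc n) (bordered d u v C)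
    ≡⟨ cong (_+ x * det (suc n) (bordered d u v C)) (det-corner n (bordered e (λ _ → 0ℚ) v C) (λ c → refl)) ⟩
  e * det n C + x * det (suc n) (bordered d u v C) ∎
  where
  open ≡-Reasoning
  same-below : ∀ {d′ u′ d″ u″} r c → bordered d′ u′ v C (suc r) c ≡ bordered d″ u″ v C (suc r) c
  same-below r zero    = refl
  same-below r (suc c) = refl
  row₀ : ∀ c → bordered (e + x * d) (λ c → x * u c) v C zero c
               ≡ bordered e (λ _ → 0ℚ) v C zero c + x * bordered d u v C zero c
  row₀ zero    = refl
  row₀ (suc c) = sym (ℚP.+-identityˡ (x * u c))

det-bordered-zero : ∀ n (u v : Fin n → ℚ) (C : Mat n) →
  det (suc n) (bordered 0ℚ u v C) ≡ det n (λ r c → C r c - v r * u c) - det n C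
det-bordered-zero n u v C = begin
  det (suc n) (bordered 0ℚ u v C)
    ≡⟨ det-cong (suc n) as-sum ⟩
  det (suc n) (bordered (- 1ℚ + 1ℚ * 1ℚ) (λ c → 1ℚ * (1ℚ * u c)) v C)
    ≡⟨ det-bordered-split n (- 1ℚ) 1ℚ 1ℚ (λ c → 1ℚ * u c) v C ⟩
  - 1ℚ * det n C + 1ℚ * det (suc n) (bordered 1ℚ (λ c → 1ℚ * u c) v C)
    ≡⟨ cong (λ y → - 1ℚ * det n C + 1ℚ * y) (det-bordered n 1ℚ u v C) ⟩
  - 1ℚ * det n C + 1ℚ * (1ℚ * det n (λ r c → C r c - v r * u c))
    ≡⟨ solve 2 (λ x y → :- con 1ℚ :* x :+ con 1ℚ :* (con 1ℚ :* y) := y :- x) refl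
             (det n C) (det n (λ r c → C r c - v r * u c)) ⟩
  det n (λ r c → C r c - v r * u c) - det n C ∎
  where
  open ≡-Reasoning
  as-sum : ∀ r c → bordered 0ℚ u v C r c ≡ bordered (- 1ℚ + 1ℚ * 1ℚ) (λ c → 1ℚ * (1ℚ * u c)) v C r c
  as-sum zero    zero    = refl
  as-sum zero    (suc c) = solve 1 (λ x → x := con 1ℚ :* (con 1ℚ :* x)) refl (u c)
  as-sum (suc r) zero    = refl
  as-sum (suc r) (suc c) = refl

⌊⌋-⇔ : ∀ {A B : Set} → A ⇔ B → (a? : Dec A) (b? : Dec B) → ⌊ a? ⌋ ≡ ⌊ b? ⌋
⌊⌋-⇔ A⇔B a? b? = trans (isYes≗does a?) (trans (does-⇔ A⇔B a? b?) (sym (isYes≗does b?)))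

δ-suc : ∀ {n} (r c : Fin n) → δ {suc n} (suc r) (suc c) ≡ δ r c
δ-suc r c = ⌊⌋-⇔ (mk⇔ FinP.suc-injective (cong suc)) (suc r ≟ suc c) (r ≟ c)

-- With unit weights this is the shape of M - λ I; a weight records how many equally labelled vertices
-- have been merged into a row.
patternMat : ∀ {L : Set} (F : L → L → ℚ) (D : L → ℚ) n → (Fin n → L) → (Fin n → ℚ) → Mat n
patternMat F D n lab w u v = w u * F (lab u) (lab v) + (if δ u v then D (lab u) else 0ℚ)

det-patternMat-reweight : ∀ {L : Set} (F : L → L → ℚ) (D : L → ℚ) n lab {w w′ : Fin n → ℚ} →
  (∀ r → w r ≡ w′ r) → det n (patternMat F D n lab w) ≡ det n (patternMat F D n lab w′)
det-patternMat-reweight F D n lab w≗w′ =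
  det-cong n (λ r c → cong (λ x → x * F (lab r) (lab c) + (if δ r c then D (lab r) else 0ℚ)) (w≗w′ r))

-- Subtracting column 1 from column 0 leaves D t (1, -1, 0, …, 0) there, and the Schur complement of its
-- corner adds row 0 to row 1.
det-merge-pair : ∀ {L : Set} (F : L → L → ℚ) (D : L → ℚ) n t lab (w₀ w₁ : ℚ) (w : Fin n → ℚ) →
  det (suc (suc n)) (patternMat F D _ (t ◂ t ◂ lab) (w₀ ◂ w₁ ◂ w)) ≡
  D t * det (suc n) (patternMat F D _ (t ◂ lab) ((w₀ + w₁) ◂ w))
det-merge-pair F D n t lab w₀ w₁ w = begin
  det N A        ≡⟨ sym (det-add-col-multiple N (suc zero) zero A A₁ (- 1ℚ) (λ ()) A₁-off₀ (λ r → refl)) ⟩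
  det N A₁       ≡⟨ det-scale-col N zero A₂ A₁ (D t) A₂-off₀ A₁-col₀ ⟩
  D t * det N A₂ ≡⟨ cong (D t *_) (trans (det-cong N A₂-bordered)
                                        (det-bordered (suc n) 1ℚ (λ c → A zero (suc c)) v (λ r c → A (suc r) (suc c)))) ⟩
  D t * (1ℚ * det (suc n) (λ r c → A (suc r) (suc c) - v r * A zero (suc c)))
                 ≡⟨ cong (D t *_) (trans (ℚP.*-identityˡ _) (det-cong (suc n) merged)) ⟩
  D t * det (suc n) (patternMat F D _ (t ◂ lab) ((w₀ + w₁) ◂ w)) ∎
  where
  open ≡-Reasoning
  N = suc (suc n)
  A = patternMat F D N (t ◂ t ◂ lab) (w₀ ◂ w₁ ◂ w)
  v : Fin (suc n) → ℚ
  v zero    = - 1ℚ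
  v (suc _) = 0ℚ
  A₁ A₂ : Mat N
  A₁ r zero    = A r zero + - 1ℚ * A r (suc zero)
  A₁ r (suc c) = A r (suc c)
  A₂ r zero    = (1ℚ ◂ v) r
  A₂ r (suc c) = A r (suc c)
  A₁-off₀ : ∀ r c → c ≢ zero → A₁ r c ≡ A r c
  A₁-off₀ r zero    0≢0 = ⊥-elim (0≢0 refl)
  A₁-off₀ r (suc c) _   = refl
  A₂-off₀ : ∀ r c → c ≢ zero → A₂ r c ≡ A₁ r c
  A₂-off₀ r zero    0≢0 = ⊥-elim (0≢0 refl)
  A₂-off₀ r (suc c) _   = refl
  A₁-col₀ : ∀ r → A₁ r zero ≡ D t * A₂ r zero
  A₁-col₀ zero          = solve 3 (λ w f d → w :* f :+ d :+ (:- con 1ℚ) :* (w :* f :+ con 0ℚ) := d :* con 1ℚ) refl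
                            w₀ (F t t) (D t)
  A₁-col₀ (suc zero)    = solve 3 (λ w f d → w :* f :+ con 0ℚ :+ (:- con 1ℚ) :* (w :* f :+ d) := d :* (:- con 1ℚ)) refl
                            w₁ (F t t) (D t)
  A₁-col₀ (suc (suc r)) = solve 3 (λ w f d → w :* f :+ con 0ℚ :+ (:- con 1ℚ) :* (w :* f :+ con 0ℚ) := d :* con 0ℚ) refl
                            (w r) (F (lab r) t) (D t)
  A₂-bordered : ∀ r c → A₂ r c ≡ bordered 1ℚ (λ c → 1ℚ * A zero (suc c)) v (λ r c → A (suc r) (suc c)) r c
  A₂-bordered zero    zero    = refl
  A₂-bordered zero    (suc c) = sym (ℚP.*-identityˡ _)
  A₂-bordered (suc r) zero    = refl
  A₂-bordered (suc r) (suc c) = refl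
  merged : ∀ r c → A (suc r) (suc c) - v r * A zero (suc c) ≡ patternMat F D _ (t ◂ lab) ((w₀ + w₁) ◂ w) r c
  merged zero    c = begin
    w₁ * F t ((t ◂ lab) c) + (if δ {N} (suc zero) (suc c) then D t else 0ℚ) - - 1ℚ * (w₀ * F t ((t ◂ lab) c) + 0ℚ)
      ≡⟨ cong (λ e → w₁ * F t ((t ◂ lab) c) + (if e then D t else 0ℚ) - - 1ℚ * (w₀ * F t ((t ◂ lab) c) + 0ℚ))
              (δ-suc zero c) ⟩
    w₁ * F t ((t ◂ lab) c) + d₀ - - 1ℚ * (w₀ * F t ((t ◂ lab) c) + 0ℚ)
      ≡⟨ solve 4 (λ a b f x → b :* f :+ x :- (:- con 1ℚ) :* (a :* f :+ con 0ℚ) := (a :+ b) :* f :+ x) refl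
               w₀ w₁ (F t ((t ◂ lab) c)) d₀ ⟩
    (w₀ + w₁) * F t ((t ◂ lab) c) + d₀ ∎
    where d₀ = if δ zero c then D t else 0ℚ
  merged (suc r) c = begin
    w r * F (lab r) ((t ◂ lab) c) + (if δ {N} (suc (suc r)) (suc c) then D (lab r) else 0ℚ) - 0ℚ * A zero (suc c)
      ≡⟨ cong (λ e → w r * F (lab r) ((t ◂ lab) c) + (if e then D (lab r) else 0ℚ) - 0ℚ * A zero (suc c))
              (δ-suc (suc r) c) ⟩
    w r * F (lab r) ((t ◂ lab) c) + dᵣ - 0ℚ * A zero (suc c)
      ≡⟨ solve 2 (λ x a → x :- con 0ℚ :* a := x) refl (w r * F (lab r) ((t ◂ lab) c) + dᵣ) (A zero (suc c)) ⟩
    w r * F (lab r) ((t ◂ lab) c) + dᵣ ∎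
    where dᵣ = if δ (suc r) c then D (lab r) else 0ℚ

prependRun : ∀ {A : Set} j {n} → A → (Fin n → A) → Fin (j ℕ.+ n) → A
prependRun zero    x f = f
prependRun (suc j) x f = x ◂ prependRun j x f

ℕtoℚ : ℕ → ℚ
ℕtoℚ n = ℤ.+ n / 1

ℕtoℚ-suc : ∀ n → 1ℚ + ℕtoℚ n ≡ ℕtoℚ (suc n)
ℕtoℚ-suc n = trans (cong (λ x → 1ℚ + x) (ℚP.normalize-coprime {n} {0} (Cop.sym (1-coprimeTo n))))
                   (cong (_/ 1) (cong₂ ℤ._+_ (ℤP.*-identityʳ (ℤ.+ 1)) (ℤP.*-identityʳ (ℤ.+ n))))

det-merge-run : ∀ {L : Set} (F : L → L → ℚ) (D : L → ℚ) j n t lab (w₀ : ℚ) (w : Fin n → ℚ) →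
  det (suc (j ℕ.+ n)) (patternMat F D _ (t ◂ prependRun j t lab) (w₀ ◂ prependRun j 1ℚ w)) ≡
  (D t ^ℚ j) * det (suc n) (patternMat F D _ (t ◂ lab) ((w₀ + ℕtoℚ j) ◂ w))
det-merge-run F D zero n t lab w₀ w = begin
  det (suc n) (patternMat F D _ (t ◂ lab) (w₀ ◂ w))
    ≡⟨ det-patternMat-reweight F D (suc n) (t ◂ lab) w₀≡ ⟩
  det (suc n) (patternMat F D _ (t ◂ lab) ((w₀ + 0ℚ) ◂ w))
    ≡⟨ sym (ℚP.*-identityˡ _) ⟩
  1ℚ * det (suc n) (patternMat F D _ (t ◂ lab) ((w₀ + 0ℚ) ◂ w)) ∎
  where
  open ≡-Reasoning
  w₀≡ : ∀ r → (w₀ ◂ w) r ≡ ((w₀ + 0ℚ) ◂ w) r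
  w₀≡ zero    = sym (ℚP.+-identityʳ w₀)
  w₀≡ (suc r) = refl
det-merge-run F D (suc j) n t lab w₀ w = begin
  det (suc (suc (j ℕ.+ n))) (patternMat F D _ (t ◂ t ◂ prependRun j t lab) (w₀ ◂ 1ℚ ◂ prependRun j 1ℚ w))
    ≡⟨ det-merge-pair F D (j ℕ.+ n) t (prependRun j t lab) w₀ 1ℚ (prependRun j 1ℚ w) ⟩
  D t * det (suc (j ℕ.+ n)) (patternMat F D _ (t ◂ prependRun j t lab) ((w₀ + 1ℚ) ◂ prependRun j 1ℚ w))
    ≡⟨ cong (D t *_) (det-merge-run F D j n t lab (w₀ + 1ℚ) w) ⟩
  D t * ((D t ^ℚ j) * det (suc n) (patternMat F D _ (t ◂ lab) ((w₀ + 1ℚ + ℕtoℚ j) ◂ w)))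
    ≡⟨ cong (λ x → D t * ((D t ^ℚ j) * x)) (det-patternMat-reweight F D (suc n) (t ◂ lab) weights) ⟩
  D t * ((D t ^ℚ j) * det (suc n) (patternMat F D _ (t ◂ lab) ((w₀ + ℕtoℚ (suc j)) ◂ w)))
    ≡⟨ sym (ℚP.*-assoc (D t) (D t ^ℚ j) _) ⟩
  (D t ^ℚ suc j) * det (suc n) (patternMat F D _ (t ◂ lab) ((w₀ + ℕtoℚ (suc j)) ◂ w)) ∎
  where
  open ≡-Reasoning
  weights : ∀ r → ((w₀ + 1ℚ + ℕtoℚ j) ◂ w) r ≡ ((w₀ + ℕtoℚ (suc j)) ◂ w) r
  weights zero    = trans (ℚP.+-assoc w₀ 1ℚ (ℕtoℚ j)) (cong (λ x → w₀ + x) (ℕtoℚ-suc j))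
  weights (suc r) = refl

data BlockLabel (m : ℕ) : Set where
  cone : Fin (suc m) → BlockLabel m
  iso  : Fin m → BlockLabel m

raise : ∀ {m} → BlockLabel m → BlockLabel (suc m)
raise (cone p) = cone (suc p)
raise (iso q)  = iso (suc q)

isCone : ∀ {m} → BlockLabel m → ℚ
isCone (cone _) = 1ℚ
isCone (iso _)  = 0ℚ

-- The entries of M as a function of the blocks, with the a_p as parameters; `diagonal` is the rest of the diagonal
-- of M - λ I (M_uu = b_q on isolates is not a function of the blocks alone).
entryPattern : ∀ {m} → (Fin (suc m) → ℚ) → (Fin m → ℚ) → BlockLabel m → BlockLabel m → ℚ
entryPattern a b (cone p) (cone p′) = - a (if ⌊ toℕ p ℕ.≤? toℕ p′ ⌋ then p else p′)
entryPattern a b (cone p) (iso q)   = if ⌊ toℕ q ℕ.<? toℕ p ⌋ then - b q else 0ℚ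
entryPattern a b (iso q)  (cone p)  = if ⌊ toℕ q ℕ.<? toℕ p ⌋ then - b q else 0ℚ
entryPattern a b (iso q)  (iso q′)  = 0ℚ

diagonal : ∀ {m} → (Fin m → ℚ) → ℚ → BlockLabel m → ℚ
diagonal b λ′ (cone _) = - λ′
diagonal b λ′ (iso q)  = b q - λ′

charMat : ∀ {m} → (Fin (suc m) → ℚ) → (Fin m → ℚ) → ℚ → ∀ n → (Fin n → BlockLabel m) → (Fin n → ℚ) → Mat n
charMat a b λ′ = patternMat (entryPattern a b) (diagonal b λ′)

det-charMat-cong : ∀ {m} {a a′ : Fin (suc m) → ℚ} b λ′ n lab w → (∀ p → a p ≡ a′ p) →
  det n (charMat a b λ′ n lab w) ≡ det n (charMat a′ b λ′ n lab w)
det-charMat-cong {a = a} {a′} b λ′ n lab w a≗a′ = det-cong n λ r c →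
  cong (λ e → w r * e + (if δ r c then diagonal b λ′ (lab r) else 0ℚ)) (pattern-cong (lab r) (lab c))
  where
  pattern-cong : ∀ x y → entryPattern a b x y ≡ entryPattern a′ b x y
  pattern-cong (cone p) (cone p′) = cong -_ (a≗a′ _)
  pattern-cong (cone p) (iso q)   = refl
  pattern-cong (iso q)  (cone p)  = refl
  pattern-cong (iso q)  (iso q′)  = refl

≤ᵇ-suc : ∀ x y → ⌊ suc x ℕ.≤? suc y ⌋ ≡ ⌊ x ℕ.≤? y ⌋
≤ᵇ-suc x y = ⌊⌋-⇔ (mk⇔ ℕ.s≤s⁻¹ ℕ.s≤s) (suc x ℕ.≤? suc y) (x ℕ.≤? y)

<ᵇ-suc : ∀ x y → ⌊ suc x ℕ.<? suc y ⌋ ≡ ⌊ x ℕ.<? y ⌋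
<ᵇ-suc x y = ⌊⌋-⇔ (mk⇔ ℕ.s<s⁻¹ ℕ.s<s) (suc x ℕ.<? suc y) (x ℕ.<? y)

entryPattern-cone₀ʳ : ∀ {m} (a : Fin (suc m) → ℚ) b x → entryPattern a b x (cone zero) ≡ isCone x * - a zero
entryPattern-cone₀ʳ a b (cone zero)    = sym (ℚP.*-identityˡ (- a zero))
entryPattern-cone₀ʳ a b (cone (suc p)) = sym (ℚP.*-identityˡ (- a zero))
entryPattern-cone₀ʳ a b (iso q)        = sym (ℚP.*-zeroˡ (- a zero))

entryPattern-cone₀ˡ : ∀ {m} (a : Fin (suc m) → ℚ) b y → entryPattern a b (cone zero) y ≡ isCone y * - a zero
entryPattern-cone₀ˡ a b (cone p) = sym (ℚP.*-identityˡ (- a zero))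
entryPattern-cone₀ˡ a b (iso q)  = sym (ℚP.*-zeroˡ (- a zero))

entryPattern-iso₀ʳ : ∀ {m} (a : Fin (suc (suc m)) → ℚ) b y → entryPattern a b (raise y) (iso zero) ≡ isCone y * - b zero
entryPattern-iso₀ʳ a b (cone p) = sym (ℚP.*-identityˡ (- b zero))
entryPattern-iso₀ʳ a b (iso q)  = sym (ℚP.*-zeroˡ (- b zero))

entryPattern-iso₀ˡ : ∀ {m} (a : Fin (suc (suc m)) → ℚ) b y → entryPattern a b (iso zero) (raise y) ≡ isCone y * - b zero
entryPattern-iso₀ˡ a b (cone p) = sym (ℚP.*-identityˡ (- b zero))
entryPattern-iso₀ˡ a b (iso q)  = sym (ℚP.*-zeroˡ (- b zero))

entryPattern-shift : ∀ {m} (a : Fin (suc m) → ℚ) b s x y →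
  entryPattern (λ p → a p + s) b x y ≡ entryPattern a b x y - isCone x * isCone y * s
entryPattern-shift a b s (cone p) (cone p′) = solve 2 (λ u s → :- (u :+ s) := :- u :- con 1ℚ :* con 1ℚ :* s) refl
                                                (a (if ⌊ toℕ p ℕ.≤? toℕ p′ ⌋ then p else p′)) s
entryPattern-shift a b s (cone p) (iso q)   = solve 2 (λ u s → u := u :- con 1ℚ :* con 0ℚ :* s) refl
                                                (entryPattern a b (cone p) (iso q)) s
entryPattern-shift a b s (iso q)  (cone p)  = solve 2 (λ u s → u := u :- con 0ℚ :* con 1ℚ :* s) refl
                                                (entryPattern a b (iso q) (cone p)) s
entryPattern-shift a b s (iso q)  (iso q′)  = solve 1 (λ s → con 0ℚ := con 0ℚ :- con 0ℚ :* con 0ℚ :* s) refl s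

entryPattern-raise : ∀ {m} (a : Fin (suc (suc m)) → ℚ) b x y →
  entryPattern a b (raise x) (raise y) ≡ entryPattern (a ∘ suc) (b ∘ suc) x y
entryPattern-raise a b (cone p) (cone p′) rewrite ≤ᵇ-suc (toℕ p) (toℕ p′) with ⌊ toℕ p ℕ.≤? toℕ p′ ⌋
... | true  = refl
... | false = refl
entryPattern-raise a b (cone p) (iso q)   rewrite <ᵇ-suc (toℕ q) (toℕ p) = refl
entryPattern-raise a b (iso q)  (cone p)  rewrite <ᵇ-suc (toℕ q) (toℕ p) = refl
entryPattern-raise a b (iso q)  (iso q′)  = refl

diagonal-raise : ∀ {m} (b : Fin (suc m) → ℚ) λ′ x → diagonal b λ′ (raise x) ≡ diagonal (b ∘ suc) λ′ x
diagonal-raise b λ′ (cone p) = refl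
diagonal-raise b λ′ (iso q)  = refl

-- After adding -isCone(c) times column 0 to each column c, row 0 is (-K a₀, 0, …, 0) + λ (-1, isCone, …):
-- below row 0 every a_p has been shifted by -a₀, and the Schur complement of the corner -1 undoes the shift.
det-peel-cone : ∀ {m} (a : Fin (suc m) → ℚ) b λ′ n lab w (K : ℚ) →
  det (suc n) (charMat a b λ′ (suc n) (cone zero ◂ lab) (K ◂ w)) ≡
  (- K * a zero) * det n (charMat (λ p → a p - a zero) b λ′ n lab w) - λ′ * det n (charMat a b λ′ n lab w)
det-peel-cone a b λ′ n lab w K = begin
  det (suc n) A
    ≡⟨ sym (det-add-col₀-multiples n A A′ (λ c → - isCone (lab c)) (λ r → refl) (λ r c → refl)) ⟩
  det (suc n) A′
    ≡⟨ det-cong (suc n) A′-bordered ⟩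
  det (suc n) (bordered (- K * a zero + λ′ * - 1ℚ) (λ c → λ′ * isCone (lab c)) v C)
    ≡⟨ det-bordered-split n (- K * a zero) λ′ (- 1ℚ) (isCone ∘ lab) v C ⟩
  (- K * a zero) * det n C + λ′ * det (suc n) (bordered (- 1ℚ) (isCone ∘ lab) v C)
    ≡⟨ cong (λ y → (- K * a zero) * det n C + λ′ * y)
            (trans (det-cong (suc n) negated) (det-bordered n (- 1ℚ) (λ c → - isCone (lab c)) v C)) ⟩
  (- K * a zero) * det n C + λ′ * (- 1ℚ * det n (λ r c → C r c - v r * - isCone (lab c)))
    ≡⟨ cong (λ y → (- K * a zero) * det n C + λ′ * (- 1ℚ * y)) (det-cong n unshifted) ⟩
  (- K * a zero) * det n C + λ′ * (- 1ℚ * det n (charMat a b λ′ n lab w))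
    ≡⟨ solve 3 (λ x y l → x :+ l :* (:- con 1ℚ :* y) := x :- l :* y) refl
             ((- K * a zero) * det n C) (det n (charMat a b λ′ n lab w)) λ′ ⟩
  (- K * a zero) * det n C - λ′ * det n (charMat a b λ′ n lab w) ∎
  where
  open ≡-Reasoning
  A = charMat a b λ′ (suc n) (cone zero ◂ lab) (K ◂ w)
  C = charMat (λ p → a p - a zero) b λ′ n lab w
  v : Fin n → ℚ
  v r = A (suc r) zero
  A′ : Mat (suc n)
  A′ r zero    = A r zero
  A′ r (suc c) = A r (suc c) + - isCone (lab c) * A r zero
  dᵣ : Fin n → Fin n → ℚ
  dᵣ r c = if δ r c then diagonal b λ′ (lab r) else 0ℚ
  below : ∀ r c → A (suc r) (suc c) ≡ w r * entryPattern a b (lab r) (lab c) + dᵣ r c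
  below r c = cong (λ e → w r * entryPattern a b (lab r) (lab c) + (if e then diagonal b λ′ (lab r) else 0ℚ)) (δ-suc r c)
  v≡ : ∀ r → v r ≡ w r * (isCone (lab r) * - a zero) + 0ℚ
  v≡ r = cong (λ e → w r * e + 0ℚ) (entryPattern-cone₀ʳ a b (lab r))
  shifted : ∀ r c → A (suc r) (suc c) + - isCone (lab c) * v r ≡ C r c
  shifted r c = begin
    A (suc r) (suc c) + - isCone (lab c) * v r
      ≡⟨ cong₂ (λ x y → x + - isCone (lab c) * y) (below r c) (v≡ r) ⟩
    w r * entryPattern a b (lab r) (lab c) + dᵣ r c + - isCone (lab c) * (w r * (isCone (lab r) * - a zero) + 0ℚ)
      ≡⟨ solve 6 (λ w e d i j a → w :* e :+ d :+ (:- j) :* (w :* (i :* (:- a)) :+ con 0ℚ)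
                                 := w :* (e :- i :* j :* (:- a)) :+ d) refl
               (w r) (entryPattern a b (lab r) (lab c)) (dᵣ r c) (isCone (lab r)) (isCone (lab c)) (a zero) ⟩
    w r * (entryPattern a b (lab r) (lab c) - isCone (lab r) * isCone (lab c) * - a zero) + dᵣ r c
      ≡⟨ cong (λ e → w r * e + dᵣ r c) (sym (entryPattern-shift a b (- a zero) (lab r) (lab c))) ⟩
    C r c ∎
  A′-bordered : ∀ r c → A′ r c ≡ bordered (- K * a zero + λ′ * - 1ℚ) (λ c → λ′ * isCone (lab c)) v C r c
  A′-bordered zero    zero    = solve 3 (λ k a l → k :* (:- a) :+ (:- l) := (:- k) :* a :+ l :* (:- con 1ℚ)) refl K (a zero) λ′
  A′-bordered zero    (suc c) =
    trans (cong (λ e → K * e + 0ℚ + - isCone (lab c) * (K * - a zero + - λ′)) (entryPattern-cone₀ˡ a b (lab c)))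
          (solve 4 (λ k a l i → k :* (i :* (:- a)) :+ con 0ℚ :+ (:- i) :* (k :* (:- a) :+ :- l) := l :* i) refl
                 K (a zero) λ′ (isCone (lab c)))
  A′-bordered (suc r) zero    = refl
  A′-bordered (suc r) (suc c) = shifted r c
  negated : ∀ r c → bordered (- 1ℚ) (isCone ∘ lab) v C r c ≡ bordered (- 1ℚ) (λ c → - 1ℚ * - isCone (lab c)) v C r c
  negated zero    zero    = refl
  negated zero    (suc c) = solve 1 (λ i → i := :- con 1ℚ :* (:- i)) refl (isCone (lab c))
  negated (suc r) zero    = refl
  negated (suc r) (suc c) = refl
  unshifted : ∀ r c → C r c - v r * - isCone (lab c) ≡ charMat a b λ′ n lab w r c
  unshifted r c = begin
    C r c - v r * - isCone (lab c)
      ≡⟨ cong (λ x → x - v r * - isCone (lab c)) (sym (shifted r c)) ⟩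
    A (suc r) (suc c) + - isCone (lab c) * v r - v r * - isCone (lab c)
      ≡⟨ solve 3 (λ x i z → x :+ (:- i) :* z :- z :* (:- i) := x) refl (A (suc r) (suc c)) (isCone (lab c)) (v r) ⟩
    A (suc r) (suc c)
      ≡⟨ below r c ⟩
    charMat a b λ′ n lab w r c ∎

-- After adding I·isCone(c) times column 0 to each column c, row 0 is (b₀ - λ, 0, …, 0) - Iλ (0, isCone, …):
-- below row 0 every a_p has been shifted by I b₀, and the second border, with corner 0, shifts it by -b₀ more.
det-peel-isolate : ∀ {m} (a : Fin (suc (suc m)) → ℚ) (b : Fin (suc m) → ℚ) λ′ n (lab : Fin n → BlockLabel m) w (I : ℚ) →
  det (suc n) (charMat a b λ′ (suc n) (iso zero ◂ raise ∘ lab) (I ◂ w)) ≡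
  (b zero - λ′) * det n (charMat (λ p → a (suc p) + I * b zero) (b ∘ suc) λ′ n lab w)
  - I * λ′ * (det n (charMat (λ p → a (suc p) + I * b zero - b zero) (b ∘ suc) λ′ n lab w)
              - det n (charMat (λ p → a (suc p) + I * b zero) (b ∘ suc) λ′ n lab w))
det-peel-isolate {m} a b λ′ n lab w I = begin
  det (suc n) A
    ≡⟨ sym (det-add-col₀-multiples n A A′ (λ c → I * isCone (lab c)) (λ r → refl) (λ r c → refl)) ⟩
  det (suc n) A′
    ≡⟨ det-cong (suc n) A′-bordered ⟩
  det (suc n) (bordered (b zero - λ′ + x * 0ℚ) (λ c → x * isCone (lab c)) v C)
    ≡⟨ det-bordered-split n (b zero - λ′) x 0ℚ (isCone ∘ lab) v C ⟩
  (b zero - λ′) * det n C + x * det (suc n) (bordered 0ℚ (isCone ∘ lab) v C)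
    ≡⟨ cong (λ y → (b zero - λ′) * det n C + x * y)
            (trans (det-bordered-zero n (isCone ∘ lab) v C) (cong (_- det n C) (det-cong n shifted))) ⟩
  (b zero - λ′) * det n C + x * (Y₋ - det n C)
    ≡⟨ solve 5 (λ b l i y y₋ → (b :- l) :* y :+ (:- (i :* l)) :* (y₋ :- y) := (b :- l) :* y :- i :* l :* (y₋ :- y)) refl
             (b zero) λ′ I (det n C) Y₋ ⟩
  (b zero - λ′) * det n C - I * λ′ * (Y₋ - det n C) ∎
  where
  open ≡-Reasoning
  x = - (I * λ′)
  a′ : Fin (suc m) → ℚ
  a′ p = a (suc p) + I * b zero
  A = charMat a b λ′ (suc n) (iso zero ◂ raise ∘ lab) (I ◂ w)
  C = charMat a′ (b ∘ suc) λ′ n lab w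
  v : Fin n → ℚ
  v r = A (suc r) zero
  Y₋ = det n (charMat (λ p → a′ p - b zero) (b ∘ suc) λ′ n lab w)
  A′ : Mat (suc n)
  A′ r zero    = A r zero
  A′ r (suc c) = A r (suc c) + I * isCone (lab c) * A r zero
  dᵣ : Fin n → Fin n → ℚ
  dᵣ r c = if δ r c then diagonal (b ∘ suc) λ′ (lab r) else 0ℚ
  below : ∀ r c → A (suc r) (suc c) ≡ w r * entryPattern (a ∘ suc) (b ∘ suc) (lab r) (lab c) + dᵣ r c
  below r c = cong₂ (λ e d → w r * e + d) (entryPattern-raise a b (lab r) (lab c))
    (trans (cong (λ e → if e then diagonal b λ′ (raise (lab r)) else 0ℚ) (δ-suc r c))
           (cong (λ d → if δ r c then d else 0ℚ) (diagonal-raise b λ′ (lab r))))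
  v≡ : ∀ r → v r ≡ w r * (isCone (lab r) * - b zero) + 0ℚ
  v≡ r = cong (λ e → w r * e + 0ℚ) (entryPattern-iso₀ʳ a b (lab r))
  A′-bordered : ∀ r c → A′ r c ≡ bordered (b zero - λ′ + x * 0ℚ) (λ c → x * isCone (lab c)) v C r c
  A′-bordered zero    zero    = solve 4 (λ i b l x → i :* con 0ℚ :+ (b :- l) := (b :- l) :+ x :* con 0ℚ) refl I (b zero) λ′ x
  A′-bordered zero    (suc c) =
    trans (cong (λ e → I * e + 0ℚ + I * isCone (lab c) * (I * 0ℚ + (b zero - λ′))) (entryPattern-iso₀ˡ a b (lab c)))
          (solve 4 (λ i j b l → i :* (j :* (:- b)) :+ con 0ℚ :+ (i :* j) :* (i :* con 0ℚ :+ (b :- l)) := (:- (i :* l)) :* j) refl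
                 I (isCone (lab c)) (b zero) λ′)
  A′-bordered (suc r) zero    = refl
  A′-bordered (suc r) (suc c) = begin
    A (suc r) (suc c) + I * isCone (lab c) * v r
      ≡⟨ cong₂ (λ u y → u + I * isCone (lab c) * y) (below r c) (v≡ r) ⟩
    w r * e + dᵣ r c + I * isCone (lab c) * (w r * (isCone (lab r) * - b zero) + 0ℚ)
      ≡⟨ solve 7 (λ w e d i j b s → w :* e :+ d :+ (s :* j) :* (w :* (i :* (:- b)) :+ con 0ℚ)
                                   := w :* (e :- i :* j :* (s :* b)) :+ d) refl
               (w r) e (dᵣ r c) (isCone (lab r)) (isCone (lab c)) (b zero) I ⟩
    w r * (e - isCone (lab r) * isCone (lab c) * (I * b zero)) + dᵣ r c
      ≡⟨ cong (λ e′ → w r * e′ + dᵣ r c) (sym (entryPattern-shift (a ∘ suc) (b ∘ suc) (I * b zero) (lab r) (lab c))) ⟩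
    C r c ∎
    where e = entryPattern (a ∘ suc) (b ∘ suc) (lab r) (lab c)
  shifted : ∀ r c → C r c - v r * isCone (lab c) ≡ charMat (λ p → a′ p - b zero) (b ∘ suc) λ′ n lab w r c
  shifted r c = begin
    w r * e + dᵣ r c - v r * isCone (lab c)
      ≡⟨ cong (λ y → w r * e + dᵣ r c - y * isCone (lab c)) (v≡ r) ⟩
    w r * e + dᵣ r c - (w r * (isCone (lab r) * - b zero) + 0ℚ) * isCone (lab c)
      ≡⟨ solve 6 (λ w e d i j b → w :* e :+ d :- (w :* (i :* (:- b)) :+ con 0ℚ) :* j := w :* (e :- i :* j :* (:- b)) :+ d) refl
               (w r) e (dᵣ r c) (isCone (lab r)) (isCone (lab c)) (b zero) ⟩
    w r * (e - isCone (lab r) * isCone (lab c) * - b zero) + dᵣ r c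
      ≡⟨ cong (λ e′ → w r * e′ + dᵣ r c) (sym (entryPattern-shift a′ (b ∘ suc) (- b zero) (lab r) (lab c))) ⟩
    charMat (λ p → a′ p - b zero) (b ∘ suc) λ′ n lab w r c ∎
    where e = entryPattern a′ (b ∘ suc) (lab r) (lab c)

prependRun-ones : ∀ j {n} r → prependRun j 1ℚ (λ (_ : Fin n) → 1ℚ) r ≡ 1ℚ
prependRun-ones zero    r       = refl
prependRun-ones (suc j) zero    = refl
prependRun-ones (suc j) (suc r) = prependRun-ones j r

det-peel-cone-block : ∀ {m} K → 1 ≤ K → ∀ (a : Fin (suc m) → ℚ) b λ′ n lab →
  det (K ℕ.+ n) (charMat a b λ′ _ (prependRun K (cone zero) lab) (λ _ → 1ℚ)) ≡
  ((- λ′) ^ℚ (K ∸ 1)) * ((- ℕtoℚ K * a zero) * det n (charMat (λ p → a p - a zero) b λ′ n lab (λ _ → 1ℚ))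
                        - λ′ * det n (charMat a b λ′ n lab (λ _ → 1ℚ)))
det-peel-cone-block (suc K) _ a b λ′ n lab = begin
  det (suc (K ℕ.+ n)) (charMat a b λ′ _ (cone zero ◂ prependRun K (cone zero) lab) (λ _ → 1ℚ))
    ≡⟨ det-patternMat-reweight (entryPattern a b) (diagonal b λ′) _ (cone zero ◂ prependRun K (cone zero) lab)
                               (λ r → sym (prependRun-ones (suc K) r)) ⟩
  det (suc (K ℕ.+ n)) (charMat a b λ′ _ (cone zero ◂ prependRun K (cone zero) lab) (1ℚ ◂ prependRun K 1ℚ (λ _ → 1ℚ)))
    ≡⟨ det-merge-run (entryPattern a b) (diagonal b λ′) K n (cone zero) lab 1ℚ (λ _ → 1ℚ) ⟩
  ((- λ′) ^ℚ K) * det (suc n) (charMat a b λ′ _ (cone zero ◂ lab) ((1ℚ + ℕtoℚ K) ◂ (λ _ → 1ℚ)))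
    ≡⟨ cong (((- λ′) ^ℚ K) *_) (det-peel-cone a b λ′ n lab (λ _ → 1ℚ) (1ℚ + ℕtoℚ K)) ⟩
  ((- λ′) ^ℚ K) * ((- (1ℚ + ℕtoℚ K) * a zero) * X₁ - λ′ * X₂)
    ≡⟨ cong (λ k → ((- λ′) ^ℚ K) * ((- k * a zero) * X₁ - λ′ * X₂)) (ℕtoℚ-suc K) ⟩
  ((- λ′) ^ℚ K) * ((- ℕtoℚ (suc K) * a zero) * X₁ - λ′ * X₂) ∎
  where
  open ≡-Reasoning
  X₁ = det n (charMat (λ p → a p - a zero) b λ′ n lab (λ _ → 1ℚ))
  X₂ = det n (charMat a b λ′ n lab (λ _ → 1ℚ))

det-peel-isolate-block : ∀ {m} I → 1 ≤ I →
  ∀ (a : Fin (suc (suc m)) → ℚ) (b : Fin (suc m) → ℚ) λ′ n (lab : Fin n → BlockLabel m) →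
  det (I ℕ.+ n) (charMat a b λ′ _ (prependRun I (iso zero) (raise ∘ lab)) (λ _ → 1ℚ)) ≡
  ((b zero - λ′) ^ℚ (I ∸ 1)) *
    ((b zero - λ′) * det n (charMat (λ p → a (suc p) + ℕtoℚ I * b zero) (b ∘ suc) λ′ n lab (λ _ → 1ℚ))
     - ℕtoℚ I * λ′ * (det n (charMat (λ p → a (suc p) + ℕtoℚ I * b zero - b zero) (b ∘ suc) λ′ n lab (λ _ → 1ℚ))
                      - det n (charMat (λ p → a (suc p) + ℕtoℚ I * b zero) (b ∘ suc) λ′ n lab (λ _ → 1ℚ))))
det-peel-isolate-block (suc I) _ a b λ′ n lab = begin
  det (suc (I ℕ.+ n)) (charMat a b λ′ _ (iso zero ◂ prependRun I (iso zero) (raise ∘ lab)) (λ _ → 1ℚ))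
    ≡⟨ det-patternMat-reweight (entryPattern a b) (diagonal b λ′) _ (iso zero ◂ prependRun I (iso zero) (raise ∘ lab))
                               (λ r → sym (prependRun-ones (suc I) r)) ⟩
  det (suc (I ℕ.+ n))
      (charMat a b λ′ _ (iso zero ◂ prependRun I (iso zero) (raise ∘ lab)) (1ℚ ◂ prependRun I 1ℚ (λ _ → 1ℚ)))
    ≡⟨ det-merge-run (entryPattern a b) (diagonal b λ′) I n (iso zero) (raise ∘ lab) 1ℚ (λ _ → 1ℚ) ⟩
  ((b zero - λ′) ^ℚ I) * det (suc n) (charMat a b λ′ _ (iso zero ◂ raise ∘ lab) ((1ℚ + ℕtoℚ I) ◂ (λ _ → 1ℚ)))
    ≡⟨ cong ((b zero - λ′) ^ℚ I *_) (det-peel-isolate a b λ′ n lab (λ _ → 1ℚ) (1ℚ + ℕtoℚ I)) ⟩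
  ((b zero - λ′) ^ℚ I) * peeled (1ℚ + ℕtoℚ I)
    ≡⟨ cong (λ i → ((b zero - λ′) ^ℚ I) * peeled i) (ℕtoℚ-suc I) ⟩
  ((b zero - λ′) ^ℚ I) * peeled (ℕtoℚ (suc I)) ∎
  where
  open ≡-Reasoning
  Y Y₋ peeled : ℚ → ℚ
  Y  i = det n (charMat (λ p → a (suc p) + i * b zero) (b ∘ suc) λ′ n lab (λ _ → 1ℚ))
  Y₋ i = det n (charMat (λ p → a (suc p) + i * b zero - b zero) (b ∘ suc) λ′ n lab (λ _ → 1ℚ))
  peeled i = (b zero - λ′) * Y i - i * λ′ * (Y₋ i - Y i)

prodℚ : ∀ {r} → (Fin r → ℚ) → ℚ
prodℚ {zero}  f = 1ℚ
prodℚ {suc r} f = f zero * prodℚ (f ∘ suc)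

^ℚ-distribˡ-+-* : ∀ x m n → x ^ℚ (m ℕ.+ n) ≡ (x ^ℚ m) * (x ^ℚ n)
^ℚ-distribˡ-+-* x zero    n = sym (ℚP.*-identityˡ _)
^ℚ-distribˡ-+-* x (suc m) n = trans (cong (x *_) (^ℚ-distribˡ-+-* x m n)) (sym (ℚP.*-assoc x (x ^ℚ m) (x ^ℚ n)))

^ℚ-pred : ∀ x n → 1 ≤ n → x * x ^ℚ (n ∸ 1) ≡ x ^ℚ n
^ℚ-pred x (suc n) _ = refl

order : ∀ m → (Fin (suc m) → ℕ) → (Fin m → ℕ) → ℕ
order zero    k i = k zero ℕ.+ 0
order (suc m) k i = k zero ℕ.+ (i zero ℕ.+ order m (k ∘ suc) (i ∘ suc))

labelling : ∀ m k i → Fin (order m k i) → BlockLabel m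
labelling zero    k i = prependRun (k zero) (cone zero) (λ ())
labelling (suc m) k i =
  prependRun (k zero) (cone zero) (prependRun (i zero) (iso zero) (raise ∘ labelling m (k ∘ suc) (i ∘ suc)))

-- a_p = α₁ + ibSuffix m i b p in the definition of M.
ibSuffix : ∀ m → (Fin m → ℕ) → (Fin m → ℚ) → Fin (suc m) → ℚ
ibSuffix zero    i b p       = 0ℚ
ibSuffix (suc m) i b zero    = ℕtoℚ (i zero) * b zero + ibSuffix m (i ∘ suc) (b ∘ suc) zero
ibSuffix (suc m) i b (suc p) = ibSuffix m (i ∘ suc) (b ∘ suc) p

polyW polyG : ∀ m → (Fin (suc m) → ℕ) → (Fin m → ℕ) → (Fin m → ℚ) → ℚ → ℚ
polyW zero    k i b λ′ = ℕtoℚ (k zero)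
polyW (suc m) k i b λ′ =
  (b zero - λ′) * (polyW m (k ∘ suc) (i ∘ suc) (b ∘ suc) λ′
                   + ℕtoℚ (k zero) * polyG m (k ∘ suc) (i ∘ suc) (b ∘ suc) λ′)
  + ℕtoℚ (k zero) * ℕtoℚ (i zero) * b zero * polyW m (k ∘ suc) (i ∘ suc) (b ∘ suc) λ′
polyG zero    k i b λ′ = 1ℚ
polyG (suc m) k i b λ′ =
  (b zero - λ′) * polyG m (k ∘ suc) (i ∘ suc) (b ∘ suc) λ′
  + ℕtoℚ (i zero) * b zero * polyW m (k ∘ suc) (i ∘ suc) (b ∘ suc) λ′

prefactor : ∀ m → (Fin (suc m) → ℕ) → (Fin m → ℕ) → (Fin m → ℚ) → ℚ → ℚ
prefactor m k i b λ′ = ((- λ′) ^ℚ (sumℕ k ∸ 1)) * prodℚ (λ q → (b q - λ′) ^ℚ (i q ∸ 1))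

sumℕ-≥ : ∀ {n} (f : Fin n → ℕ) p → f p ≤ sumℕ f
sumℕ-≥ f zero    = ℕP.m≤m+n (f zero) _
sumℕ-≥ f (suc p) = ℕP.≤-trans (sumℕ-≥ (f ∘ suc) p) (ℕP.m≤n+m _ (f zero))

prefactor-suc : ∀ m k i b λ′ → (∀ p → 1 ≤ k p) →
  prefactor (suc m) k i b λ′ ≡
  ((- λ′) ^ℚ (k zero ∸ 1)) * ((b zero - λ′) ^ℚ (i zero ∸ 1))
  * (- λ′ * prefactor m (k ∘ suc) (i ∘ suc) (b ∘ suc) λ′)
prefactor-suc m k i b λ′ hk = begin
  (x ^ℚ (k zero ℕ.+ S ∸ 1)) * (P₂ * Q)           ≡⟨ cong (λ e → (x ^ℚ e) * (P₂ * Q)) (ℕP.+-∸-comm S (hk zero)) ⟩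
  (x ^ℚ (k zero ∸ 1 ℕ.+ S)) * (P₂ * Q)           ≡⟨ cong (_* (P₂ * Q)) (^ℚ-distribˡ-+-* x (k zero ∸ 1) S) ⟩
  (x ^ℚ (k zero ∸ 1)) * (x ^ℚ S) * (P₂ * Q)
    ≡⟨ cong (λ y → (x ^ℚ (k zero ∸ 1)) * y * (P₂ * Q)) (sym (^ℚ-pred x S S≥1)) ⟩
  (x ^ℚ (k zero ∸ 1)) * (x * x ^ℚ (S ∸ 1)) * (P₂ * Q)
    ≡⟨ solve 5 (λ p₁ x y p₂ q → p₁ :* (x :* y) :* (p₂ :* q) := p₁ :* p₂ :* (x :* (y :* q))) refl
             (x ^ℚ (k zero ∸ 1)) x (x ^ℚ (S ∸ 1)) P₂ Q ⟩
  (x ^ℚ (k zero ∸ 1)) * P₂ * (x * ((x ^ℚ (S ∸ 1)) * Q)) ∎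
  where
  open ≡-Reasoning
  x = - λ′
  S = sumℕ (k ∘ suc)
  P₂ = (b zero - λ′) ^ℚ (i zero ∸ 1)
  Q = prodℚ (λ q → (b (suc q) - λ′) ^ℚ (i (suc q) ∸ 1))
  S≥1 : 1 ≤ S
  S≥1 = ℕP.≤-trans (hk (suc zero)) (sumℕ-≥ (k ∘ suc) zero)

det-prepend-isolates : ∀ {m} I → 1 ≤ I →
  ∀ (b : Fin (suc m) → ℚ) λ′ n (lab : Fin n → BlockLabel m) (c : Fin (suc m) → ℚ) C G W →
  (∀ t → det n (charMat (λ p → t + c p) (b ∘ suc) λ′ n lab (λ _ → 1ℚ)) ≡ C * (- λ′ * G - (t + c zero) * W)) →
  ∀ (a : Fin (suc (suc m)) → ℚ) t → (∀ p → a (suc p) + ℕtoℚ I * b zero ≡ t + c p) →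
  det (I ℕ.+ n) (charMat a b λ′ _ (prependRun I (iso zero) (raise ∘ lab)) (λ _ → 1ℚ)) ≡
  ((b zero - λ′) ^ℚ (I ∸ 1)) * (C * ((b zero - λ′) * (- λ′ * G - (t + c zero) * W) - ℕtoℚ I * λ′ * b zero * W))
det-prepend-isolates I I≥1 b λ′ n lab c C G W tail a t shifted = begin
  det (I ℕ.+ n) (charMat a b λ′ _ (prependRun I (iso zero) (raise ∘ lab)) (λ _ → 1ℚ))
    ≡⟨ det-peel-isolate-block I I≥1 a b λ′ n lab ⟩
  P * ((b zero - λ′) * Y₀ - ℕtoℚ I * λ′ * (Y₋ - Y₀))
    ≡⟨ cong₂ (λ y₀ y₋ → P * ((b zero - λ′) * y₀ - ℕtoℚ I * λ′ * (y₋ - y₀)))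
             (trans (det-charMat-cong (b ∘ suc) λ′ n lab (λ _ → 1ℚ) shifted) (tail t))
             (trans (det-charMat-cong (b ∘ suc) λ′ n lab (λ _ → 1ℚ) shifted₋) (tail (t - b zero))) ⟩
  P * ((b zero - λ′) * (C * s t) - ℕtoℚ I * λ′ * (C * s (t - b zero) - C * s t))
    ≡⟨ solve 9 (λ p b l i C g w t d → p :* ((b :- l) :* (C :* (:- l :* g :- (t :+ d) :* w))
                                           :- i :* l :* (C :* (:- l :* g :- (t :- b :+ d) :* w) :- C :* (:- l :* g :- (t :+ d) :* w)))
                                      := p :* (C :* ((b :- l) :* (:- l :* g :- (t :+ d) :* w) :- i :* l :* b :* w))) refl
             P (b zero) λ′ (ℕtoℚ I) C G W t (c zero) ⟩
  P * (C * ((b zero - λ′) * s t - ℕtoℚ I * λ′ * b zero * W)) ∎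
  where
  open ≡-Reasoning
  P = (b zero - λ′) ^ℚ (I ∸ 1)
  s : ℚ → ℚ
  s t′ = - λ′ * G - (t′ + c zero) * W
  Y₀ = det n (charMat (λ p → a (suc p) + ℕtoℚ I * b zero) (b ∘ suc) λ′ n lab (λ _ → 1ℚ))
  Y₋ = det n (charMat (λ p → a (suc p) + ℕtoℚ I * b zero - b zero) (b ∘ suc) λ′ n lab (λ _ → 1ℚ))
  shifted₋ : ∀ p → a (suc p) + ℕtoℚ I * b zero - b zero ≡ t - b zero + c p
  shifted₋ p = trans (cong (_- b zero) (shifted p)) (solve 3 (λ t c b → t :+ c :- b := t :- b :+ c) refl t (c p) (b zero))

det-charMat-threshold : ∀ m k i b → (∀ p → 1 ≤ k p) → (∀ q → 1 ≤ i q) → ∀ t λ′ →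
  det (order m k i) (charMat (λ p → t + ibSuffix m i b p) b λ′ _ (labelling m k i) (λ _ → 1ℚ)) ≡
  prefactor m k i b λ′ * (- λ′ * polyG m k i b λ′ - (t + ibSuffix m i b zero) * polyW m k i b λ′)
det-charMat-threshold zero k i b hk hi t λ′ = begin
  det (k zero ℕ.+ 0) (charMat (λ p → t + 0ℚ) b λ′ _ (labelling zero k i) (λ _ → 1ℚ))
    ≡⟨ det-peel-cone-block (k zero) (hk zero) (λ p → t + 0ℚ) b λ′ 0 (λ ()) ⟩
  P * ((- K * (t + 0ℚ)) * 1ℚ - λ′ * 1ℚ)
    ≡⟨ solve 4 (λ P K t l → P :* ((:- K :* (t :+ con 0ℚ)) :* con 1ℚ :- l :* con 1ℚ)
                          := (P :* con 1ℚ) :* (:- l :* con 1ℚ :- (t :+ con 0ℚ) :* K)) refl P K t λ′ ⟩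
  (P * 1ℚ) * (- λ′ * 1ℚ - (t + 0ℚ) * K)
    ≡⟨ cong (λ e → ((- λ′) ^ℚ (e ∸ 1) * 1ℚ) * (- λ′ * 1ℚ - (t + 0ℚ) * K)) (sym (ℕP.+-identityʳ (k zero))) ⟩
  prefactor zero k i b λ′ * (- λ′ * 1ℚ - (t + 0ℚ) * K) ∎
  where
  open ≡-Reasoning
  K = ℕtoℚ (k zero)
  P = (- λ′) ^ℚ (k zero ∸ 1)
det-charMat-threshold (suc m) k i b hk hi t λ′ = begin
  det _ (charMat a b λ′ _ (labelling (suc m) k i) (λ _ → 1ℚ))
    ≡⟨ det-peel-cone-block (k zero) (hk zero) a b λ′ _ rest ⟩
  P₁ * ((- K * a zero) * det _ (charMat (λ p → a p - a zero) b λ′ _ rest (λ _ → 1ℚ))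
        - λ′ * det _ (charMat a b λ′ _ rest (λ _ → 1ℚ)))
    ≡⟨ cong₂ (λ x y → P₁ * ((- K * a zero) * x - λ′ * y))
             (isolates (λ p → a p - a zero) (t - a zero + I * b zero)
                (λ p → solve 4 (λ t c a s → t :+ c :- a :+ s := t :- a :+ s :+ c) refl t (c′ p) (a zero) (I * b zero)))
             (isolates a (t + I * b zero) (λ p → solve 3 (λ t c s → t :+ c :+ s := t :+ s :+ c) refl t (c′ p) (I * b zero))) ⟩
  P₁ * ((- K * a zero) * (P₂ * (C′ * u (t - a zero + I * b zero))) - λ′ * (P₂ * (C′ * u (t + I * b zero))))
    ≡⟨ cong (λ v → P₁ * ((- K * a zero) * (P₂ * (C′ * v)) - λ′ * (P₂ * (C′ * u (t + I * b zero))))) cone-shifted ⟩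
  P₁ * ((- K * a zero) * (P₂ * (C′ * (- λ′ * G))) - λ′ * (P₂ * (C′ * u (t + I * b zero))))
    ≡⟨ solve 7 (λ p₁ p₂ c x y z v → p₁ :* (x :* (p₂ :* (c :* y)) :- z :* (p₂ :* (c :* v)))
                                   := p₁ :* p₂ :* c :* (x :* y :- z :* v)) refl
             P₁ P₂ C′ (- K * a zero) (- λ′ * G) λ′ (u (t + I * b zero)) ⟩
  P₁ * P₂ * C′ * ((- K * a zero) * (- λ′ * G) - λ′ * u (t + I * b zero))
    ≡⟨ cong (P₁ * P₂ * C′ *_) combine ⟩
  P₁ * P₂ * C′ * (- λ′ * (- λ′ * G - a zero * W))
    ≡⟨ solve 5 (λ p₁ p₂ c l x → p₁ :* p₂ :* c :* (:- l :* x) := p₁ :* p₂ :* (:- l :* c) :* x) refl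
             P₁ P₂ C′ λ′ (- λ′ * G - a zero * W) ⟩
  P₁ * P₂ * (- λ′ * C′) * (- λ′ * G - a zero * W)
    ≡⟨ cong (_* (- λ′ * G - a zero * W)) (sym (prefactor-suc m k i b λ′ hk)) ⟩
  prefactor (suc m) k i b λ′ * (- λ′ * G - a zero * W) ∎
  where
  open ≡-Reasoning
  a = λ p → t + ibSuffix (suc m) i b p
  c′ = ibSuffix m (i ∘ suc) (b ∘ suc)
  rest = prependRun (i zero) (iso zero) (raise ∘ labelling m (k ∘ suc) (i ∘ suc))
  K = ℕtoℚ (k zero)
  I = ℕtoℚ (i zero)
  P₁ = (- λ′) ^ℚ (k zero ∸ 1)
  P₂ = (b zero - λ′) ^ℚ (i zero ∸ 1)
  C′ = prefactor m (k ∘ suc) (i ∘ suc) (b ∘ suc) λ′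
  G′ = polyG m (k ∘ suc) (i ∘ suc) (b ∘ suc) λ′
  W′ = polyW m (k ∘ suc) (i ∘ suc) (b ∘ suc) λ′
  G = polyG (suc m) k i b λ′
  W = polyW (suc m) k i b λ′
  u : ℚ → ℚ
  u t′ = (b zero - λ′) * (- λ′ * G′ - (t′ + c′ zero) * W′) - I * λ′ * b zero * W′
  isolates : ∀ a′ t′ → (∀ p → a′ (suc p) + I * b zero ≡ t′ + c′ p) →
    det _ (charMat a′ b λ′ _ rest (λ _ → 1ℚ)) ≡ P₂ * (C′ * u t′)
  isolates = det-prepend-isolates (i zero) (hi zero) b λ′ _ (labelling m (k ∘ suc) (i ∘ suc)) c′ C′ G′ W′
               (λ t′ → det-charMat-threshold m (k ∘ suc) (i ∘ suc) (b ∘ suc) (hk ∘ suc) (hi ∘ suc) t′ λ′)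
  -- After the cone block is peeled off, a_p - a₀ is shifted back by I b₀ only, so a₀ drops out.
  cone-shifted : u (t - a zero + I * b zero) ≡ - λ′ * G
  cone-shifted = solve 7 (λ b l g w t i c →
      (b :- l) :* (:- l :* g :- ((t :- (t :+ (i :* b :+ c)) :+ i :* b) :+ c) :* w) :- i :* l :* b :* w
    := :- l :* ((b :- l) :* g :+ i :* b :* w)) refl
                   (b zero) λ′ G′ W′ t I (c′ zero)
  combine : (- K * a zero) * (- λ′ * G) - λ′ * u (t + I * b zero) ≡ - λ′ * (- λ′ * G - a zero * W)
  combine = solve 8 (λ k b l g w t i c →
      (:- k :* (t :+ (i :* b :+ c))) :* (:- l :* ((b :- l) :* g :+ i :* b :* w))
      :- l :* ((b :- l) :* (:- l :* g :- ((t :+ i :* b) :+ c) :* w) :- i :* l :* b :* w)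
    := :- l :* (:- l :* ((b :- l) :* g :+ i :* b :* w) :- (t :+ (i :* b :+ c)) :* ((b :- l) :* (w :+ k :* g) :+ k :* i :* b :* w))) refl
    K (b zero) λ′ G′ W′ t I (c′ zero)

sumBoolVec-cong : ∀ m {F G : Vec Bool m → ℚ} → (∀ ε → F ε ≡ G ε) → sumBoolVec m F ≡ sumBoolVec m G
sumBoolVec-cong zero    F≗G = F≗G []
sumBoolVec-cong (suc m) F≗G = cong₂ _+_ (sumBoolVec-cong m (F≗G ∘ (false ∷_))) (sumBoolVec-cong m (F≗G ∘ (true ∷_)))

sumBoolVec-linear : ∀ m (F G : Vec Bool m → ℚ) x →
  sumBoolVec m (λ ε → F ε + x * G ε) ≡ sumBoolVec m F + x * sumBoolVec m G
sumBoolVec-linear zero    F G x = refl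
sumBoolVec-linear (suc m) F G x =
  trans (cong₂ _+_ (sumBoolVec-linear m _ _ x) (sumBoolVec-linear m _ _ x))
        (solve 5 (λ a b c d x → (a :+ x :* b) :+ (c :+ x :* d) := (a :+ c) :+ x :* (b :+ d)) refl
               (sumBoolVec m (F ∘ (false ∷_))) (sumBoolVec m (G ∘ (false ∷_)))
               (sumBoolVec m (F ∘ (true ∷_))) (sumBoolVec m (G ∘ (true ∷_))) x)

sumBoolVec-scale : ∀ m (F : Vec Bool m → ℚ) x → sumBoolVec m (λ ε → x * F ε) ≡ x * sumBoolVec m F
sumBoolVec-scale zero    F x = refl
sumBoolVec-scale (suc m) F x =
  trans (cong₂ _+_ (sumBoolVec-scale m _ x) (sumBoolVec-scale m _ x)) (sym (ℚP.*-distribˡ-+ x _ _))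

basis : ∀ {m} → (Fin m → ℚ) → ℚ → Vec Bool m → ℚ
basis b λ′ ε = prodℚ (λ q → if lookup ε q then 1ℚ else b q - λ′)

expand : ∀ m → (Fin m → ℚ) → ℚ → (Vec Bool m → ℚ) → ℚ
expand m b λ′ c = sumBoolVec m (λ ε → c ε * basis b λ′ ε)

expand-cong : ∀ m b λ′ {c c′ : Vec Bool m → ℚ} → (∀ ε → c ε ≡ c′ ε) → expand m b λ′ c ≡ expand m b λ′ c′
expand-cong m b λ′ c≗c′ = sumBoolVec-cong m (λ ε → cong (_* basis b λ′ ε) (c≗c′ ε))

expand-suc : ∀ m (b : Fin (suc m) → ℚ) λ′ c → expand (suc m) b λ′ c ≡
  (b zero - λ′) * expand m (b ∘ suc) λ′ (c ∘ (false ∷_)) + expand m (b ∘ suc) λ′ (c ∘ (true ∷_))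
expand-suc m b λ′ c = cong₂ _+_
  (trans (sumBoolVec-cong m (λ ε → solve 3 (λ c x l → c :* (x :* l) := x :* (c :* l)) refl
                                           (c (false ∷ ε)) (b zero - λ′) (basis (b ∘ suc) λ′ ε)))
         (sumBoolVec-scale m _ (b zero - λ′)))
  (sumBoolVec-cong m (λ ε → cong (c (true ∷ ε) *_) (ℚP.*-identityˡ _)))

expand-linear : ∀ m b λ′ (c d : Vec Bool m → ℚ) x →
  expand m b λ′ (λ ε → c ε + x * d ε) ≡ expand m b λ′ c + x * expand m b λ′ d
expand-linear m b λ′ c d x =
  trans (sumBoolVec-cong m (λ ε → solve 4 (λ c d x l → (c :+ x :* d) :* l := c :* l :+ x :* (d :* l)) refl
                                          (c ε) (d ε) x (basis b λ′ ε)))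
        (sumBoolVec-linear m _ _ x)

expand-scale : ∀ m b λ′ (c : Vec Bool m → ℚ) x → expand m b λ′ (λ ε → x * c ε) ≡ x * expand m b λ′ c
expand-scale m b λ′ c x = trans (sumBoolVec-cong m (λ ε → ℚP.*-assoc x (c ε) (basis b λ′ ε))) (sumBoolVec-scale m _ x)

mutual
  coeffW : ∀ m → (Fin (suc m) → ℕ) → (Fin m → ℕ) → (Fin m → ℚ) → Vec Bool m → ℚ
  coeffW zero    k i b []          = ℕtoℚ (k zero)
  coeffW (suc m) k i b (false ∷ ε) =
    coeffW m (k ∘ suc) (i ∘ suc) (b ∘ suc) ε + ℕtoℚ (k zero) * coeffG m (k ∘ suc) (i ∘ suc) (b ∘ suc) ε
  coeffW (suc m) k i b (true ∷ ε)  = ℕtoℚ (k zero) * ℕtoℚ (i zero) * b zero * coeffW m (k ∘ suc) (i ∘ suc) (b ∘ suc) ε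

  coeffG : ∀ m → (Fin (suc m) → ℕ) → (Fin m → ℕ) → (Fin m → ℚ) → Vec Bool m → ℚ
  coeffG zero    k i b []          = 1ℚ
  coeffG (suc m) k i b (false ∷ ε) = coeffG m (k ∘ suc) (i ∘ suc) (b ∘ suc) ε
  coeffG (suc m) k i b (true ∷ ε)  = ℕtoℚ (i zero) * b zero * coeffW m (k ∘ suc) (i ∘ suc) (b ∘ suc) ε

-- The coefficients of λ (polyG - ∏_q (b_q - λ)); the factor λ is absorbed through λ = b_q - (b_q - λ).
coeffE : ∀ m → (Fin (suc m) → ℕ) → (Fin m → ℕ) → (Fin m → ℚ) → Vec Bool m → ℚ
coeffE zero    k i b []          = 0ℚ
coeffE (suc m) k i b (false ∷ ε) =
  coeffE m (k ∘ suc) (i ∘ suc) (b ∘ suc) ε + - (ℕtoℚ (i zero) * b zero) * coeffW m (k ∘ suc) (i ∘ suc) (b ∘ suc) ε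
coeffE (suc m) k i b (true ∷ ε)  = ℕtoℚ (i zero) * b zero * b zero * coeffW m (k ∘ suc) (i ∘ suc) (b ∘ suc) ε

isFalses : ∀ m → Vec Bool m → ℚ
isFalses zero    []          = 1ℚ
isFalses (suc m) (false ∷ ε) = isFalses m ε
isFalses (suc m) (true ∷ ε)  = 0ℚ

isFalses-cases : ∀ m (ε : Vec Bool m) → isFalses m ε ≡ 0ℚ ⊎ (isFalses m ε ≡ 1ℚ × ε ≡ replicate m false)
isFalses-cases zero    []          = inj₂ (refl , refl)
isFalses-cases (suc m) (true ∷ ε)  = inj₁ refl
isFalses-cases (suc m) (false ∷ ε) with isFalses-cases m ε
... | inj₁ is0        = inj₁ is0
... | inj₂ (is1 , ε≡) = inj₂ (is1 , cong (false ∷_) ε≡)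

mutual
  expand-coeffW : ∀ m k i b λ′ → expand m b λ′ (coeffW m k i b) ≡ polyW m k i b λ′
  expand-coeffW zero    k i b λ′ = ℚP.*-identityʳ _
  expand-coeffW (suc m) k i b λ′ = begin
    expand (suc m) b λ′ (coeffW (suc m) k i b)
      ≡⟨ expand-suc m b λ′ (coeffW (suc m) k i b) ⟩
    (b zero - λ′) * expand m (b ∘ suc) λ′ (λ ε → W ε + K * G ε) + expand m (b ∘ suc) λ′ (λ ε → K * I * b zero * W ε)
      ≡⟨ cong₂ (λ x y → (b zero - λ′) * x + y)
               (expand-linear m (b ∘ suc) λ′ W G K) (expand-scale m (b ∘ suc) λ′ W (K * I * b zero)) ⟩
    (b zero - λ′) * (expand m (b ∘ suc) λ′ W + K * expand m (b ∘ suc) λ′ G) + K * I * b zero * expand m (b ∘ suc) λ′ W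
      ≡⟨ cong₂ (λ x y → (b zero - λ′) * (x + K * y) + K * I * b zero * x)
               (expand-coeffW m (k ∘ suc) (i ∘ suc) (b ∘ suc) λ′) (expand-coeffG m (k ∘ suc) (i ∘ suc) (b ∘ suc) λ′) ⟩
    polyW (suc m) k i b λ′ ∎
    where
    open ≡-Reasoning
    W = coeffW m (k ∘ suc) (i ∘ suc) (b ∘ suc)
    G = coeffG m (k ∘ suc) (i ∘ suc) (b ∘ suc)
    K = ℕtoℚ (k zero)
    I = ℕtoℚ (i zero)

  expand-coeffG : ∀ m k i b λ′ → expand m b λ′ (coeffG m k i b) ≡ polyG m k i b λ′
  expand-coeffG zero    k i b λ′ = ℚP.*-identityʳ _
  expand-coeffG (suc m) k i b λ′ = begin
    expand (suc m) b λ′ (coeffG (suc m) k i b)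
      ≡⟨ expand-suc m b λ′ (coeffG (suc m) k i b) ⟩
    (b zero - λ′) * expand m (b ∘ suc) λ′ G + expand m (b ∘ suc) λ′ (λ ε → I * b zero * W ε)
      ≡⟨ cong₂ (λ x y → (b zero - λ′) * x + y)
               (expand-coeffG m (k ∘ suc) (i ∘ suc) (b ∘ suc) λ′) (expand-scale m (b ∘ suc) λ′ W (I * b zero)) ⟩
    (b zero - λ′) * polyG m (k ∘ suc) (i ∘ suc) (b ∘ suc) λ′ + I * b zero * expand m (b ∘ suc) λ′ W
      ≡⟨ cong (λ y → (b zero - λ′) * polyG m (k ∘ suc) (i ∘ suc) (b ∘ suc) λ′ + I * b zero * y)
              (expand-coeffW m (k ∘ suc) (i ∘ suc) (b ∘ suc) λ′) ⟩
    polyG (suc m) k i b λ′ ∎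
    where
    open ≡-Reasoning
    W = coeffW m (k ∘ suc) (i ∘ suc) (b ∘ suc)
    G = coeffG m (k ∘ suc) (i ∘ suc) (b ∘ suc)
    I = ℕtoℚ (i zero)

expand-isFalses : ∀ m b λ′ → expand m b λ′ (isFalses m) ≡ basis b λ′ (replicate m false)
expand-isFalses zero    b λ′ = ℚP.*-identityʳ _
expand-isFalses (suc m) b λ′ = begin
  expand (suc m) b λ′ (isFalses (suc m))
    ≡⟨ expand-suc m b λ′ (isFalses (suc m)) ⟩
  (b zero - λ′) * expand m (b ∘ suc) λ′ (isFalses m) + expand m (b ∘ suc) λ′ (λ _ → 0ℚ)
    ≡⟨ cong₂ (λ x y → (b zero - λ′) * x + y) (expand-isFalses m (b ∘ suc) λ′)
             (trans (expand-scale m (b ∘ suc) λ′ (λ _ → 1ℚ) 0ℚ)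
                    (ℚP.*-zeroˡ (expand m (b ∘ suc) λ′ (λ _ → 1ℚ)))) ⟩
  (b zero - λ′) * basis (b ∘ suc) λ′ (replicate m false) + 0ℚ
    ≡⟨ ℚP.+-identityʳ _ ⟩
  basis b λ′ (replicate (suc m) false) ∎
  where open ≡-Reasoning

expand-coeffE : ∀ m k i b λ′ →
  expand m b λ′ (coeffE m k i b) ≡ λ′ * (polyG m k i b λ′ - basis b λ′ (replicate m false))
expand-coeffE zero    k i b λ′ = solve 1 (λ l → con 0ℚ :* con 1ℚ := l :* (con 1ℚ :- con 1ℚ)) refl λ′
expand-coeffE (suc m) k i b λ′ = begin
  expand (suc m) b λ′ (coeffE (suc m) k i b)
    ≡⟨ expand-suc m b λ′ (coeffE (suc m) k i b) ⟩
  (b zero - λ′) * expand m (b ∘ suc) λ′ (λ ε → E ε + - (I * b zero) * W ε)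
  + expand m (b ∘ suc) λ′ (λ ε → I * b zero * b zero * W ε)
    ≡⟨ cong₂ (λ x y → (b zero - λ′) * x + y)
             (expand-linear m (b ∘ suc) λ′ E W (- (I * b zero))) (expand-scale m (b ∘ suc) λ′ W (I * b zero * b zero)) ⟩
  (b zero - λ′) * (expand m (b ∘ suc) λ′ E + - (I * b zero) * expand m (b ∘ suc) λ′ W)
  + I * b zero * b zero * expand m (b ∘ suc) λ′ W
    ≡⟨ cong₂ (λ x y → (b zero - λ′) * (x + - (I * b zero) * y) + I * b zero * b zero * y)
             (expand-coeffE m (k ∘ suc) (i ∘ suc) (b ∘ suc) λ′) (expand-coeffW m (k ∘ suc) (i ∘ suc) (b ∘ suc) λ′) ⟩
  (b zero - λ′) * (λ′ * (G′ - P′) + - (I * b zero) * W′) + I * b zero * b zero * W′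
    ≡⟨ solve 6 (λ b l g p i w → (b :- l) :* (l :* (g :- p) :+ (:- (i :* b)) :* w) :+ i :* b :* b :* w
                               := l :* (((b :- l) :* g :+ i :* b :* w) :- (b :- l) :* p)) refl
             (b zero) λ′ G′ P′ I W′ ⟩
  λ′ * (polyG (suc m) k i b λ′ - basis b λ′ (replicate (suc m) false)) ∎
  where
  open ≡-Reasoning
  W = coeffW m (k ∘ suc) (i ∘ suc) (b ∘ suc)
  E = coeffE m (k ∘ suc) (i ∘ suc) (b ∘ suc)
  I = ℕtoℚ (i zero)
  G′ = polyG m (k ∘ suc) (i ∘ suc) (b ∘ suc) λ′
  W′ = polyW m (k ∘ suc) (i ∘ suc) (b ∘ suc) λ′
  P′ = basis (b ∘ suc) λ′ (replicate m false)

pos*pos : ∀ {x y} → 0ℚ < x → 0ℚ < y → 0ℚ < x * y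
pos*pos {x} {y} 0<x 0<y = ℚP.positive⁻¹ (x * y) {{ℚP.pos*pos⇒pos x {{positive 0<x}} y {{positive 0<y}}}}

nonNeg*nonNeg : ∀ {x y} → 0ℚ ℚ.≤ x → 0ℚ ℚ.≤ y → 0ℚ ℚ.≤ x * y
nonNeg*nonNeg {x} {y} 0≤x 0≤y =
  ℚP.nonNegative⁻¹ (x * y) {{ℚP.nonNeg*nonNeg⇒nonNeg x {{nonNegative 0≤x}} y {{nonNegative 0≤y}}}}

pos+nonNeg : ∀ {x y} → 0ℚ < x → 0ℚ ℚ.≤ y → 0ℚ < x + y
pos+nonNeg {x} {y} 0<x 0≤y = subst (_< x + y) (ℚP.+-identityʳ 0ℚ) (ℚP.+-mono-<-≤ 0<x 0≤y)

ℕtoℚ-pos : ∀ n → 1 ≤ n → 0ℚ < ℕtoℚ n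
ℕtoℚ-pos (suc n) _ = ℚP.positive⁻¹ (ℕtoℚ (suc n)) {{ℚP.normalize-pos (suc n) 1}}

mutual
  coeffW-pos : ∀ m k i b → (∀ p → 1 ≤ k p) → (∀ q → 1 ≤ i q) → (∀ q → 0ℚ < b q) →
    ∀ ε → 0ℚ < coeffW m k i b ε
  coeffW-pos zero    k i b hk hi hb []          = ℕtoℚ-pos (k zero) (hk zero)
  coeffW-pos (suc m) k i b hk hi hb (false ∷ ε) =
    pos+nonNeg (coeffW-pos m _ _ _ (hk ∘ suc) (hi ∘ suc) (hb ∘ suc) ε)
               (nonNeg*nonNeg (ℚP.<⇒≤ (ℕtoℚ-pos (k zero) (hk zero)))
                              (coeffG-nonNeg m _ _ _ (hk ∘ suc) (hi ∘ suc) (hb ∘ suc) ε))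
  coeffW-pos (suc m) k i b hk hi hb (true ∷ ε)  =
    pos*pos (pos*pos (pos*pos (ℕtoℚ-pos (k zero) (hk zero)) (ℕtoℚ-pos (i zero) (hi zero))) (hb zero))
            (coeffW-pos m _ _ _ (hk ∘ suc) (hi ∘ suc) (hb ∘ suc) ε)

  coeffG-nonNeg : ∀ m k i b → (∀ p → 1 ≤ k p) → (∀ q → 1 ≤ i q) → (∀ q → 0ℚ < b q) →
    ∀ ε → 0ℚ ℚ.≤ coeffG m k i b ε
  coeffG-nonNeg zero    k i b hk hi hb []          = ℚP.<⇒≤ (ℚP.positive⁻¹ 1ℚ)
  coeffG-nonNeg (suc m) k i b hk hi hb (false ∷ ε) = coeffG-nonNeg m _ _ _ (hk ∘ suc) (hi ∘ suc) (hb ∘ suc) ε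
  coeffG-nonNeg (suc m) k i b hk hi hb (true ∷ ε)  =
    ℚP.<⇒≤ (pos*pos (pos*pos (ℕtoℚ-pos (i zero) (hi zero)) (hb zero))
                    (coeffW-pos m _ _ _ (hk ∘ suc) (hi ∘ suc) (hb ∘ suc) ε))

lookup-map : ∀ {A B : Set} (f : A → B) xs u →
  List.lookup (List.map f xs) u ≡ f (List.lookup xs (Fin.cast (ListP.length-map f xs) u))
lookup-map f (x ∷ xs) zero    = refl
lookup-map f (x ∷ xs) (suc u) = lookup-map f xs u

module _ {m : ℕ} {k : Fin (suc m) → ℕ} {i : Fin m → ℕ} where

  open Block m k i using (Label)

  toBlockLabel : Label → BlockLabel m
  toBlockLabel (Label.cone p) = cone p
  toBlockLabel (Label.iso q)  = iso q

  Represents : List Label → ∀ n → (Fin n → BlockLabel m) → Set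
  Represents xs n f = Σ (length xs ≡ n) λ len → ∀ u → toBlockLabel (List.lookup xs u) ≡ f (Fin.cast len u)

  represents-prependRun : ∀ j x ys n (f : Fin n → BlockLabel m) →
    Represents ys n f → Represents (List.replicate j x ++ ys) (j ℕ.+ n) (prependRun j (toBlockLabel x) f)
  represents-prependRun zero    x ys n f rep = rep
  represents-prependRun (suc j) x ys n f rep with represents-prependRun j x ys n f rep
  ... | len , same = cong suc len , λ { zero → refl ; (suc u) → same u }

module _ {m : ℕ} {k : Fin (suc (suc m)) → ℕ} {i : Fin (suc m) → ℕ} where

  open Block (suc m) k i using (Label)
  private module Tail = Block m (k ∘ suc) (i ∘ suc)

  raiseLabel : Tail.Label → Label
  raiseLabel (Tail.Label.cone p) = Label.cone (suc p)
  raiseLabel (Tail.Label.iso q)  = Label.iso (suc q)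

  toBlockLabel-raise : ∀ x → toBlockLabel (raiseLabel x) ≡ raise (toBlockLabel x)
  toBlockLabel-raise (Tail.Label.cone p) = refl
  toBlockLabel-raise (Tail.Label.iso q)  = refl

  represents-raise : ∀ ys n (f : Fin n → BlockLabel m) → Represents ys n f →
    Represents (List.map raiseLabel ys) n (raise ∘ f)
  represents-raise ys n f (len , same) = trans len-map len , λ u → begin
    toBlockLabel (List.lookup (List.map raiseLabel ys) u)     ≡⟨ cong toBlockLabel (lookup-map raiseLabel ys u) ⟩
    toBlockLabel (raiseLabel (List.lookup ys (Fin.cast len-map u)))
                                                              ≡⟨ toBlockLabel-raise _ ⟩
    raise (toBlockLabel (List.lookup ys (Fin.cast len-map u))) ≡⟨ cong raise (same _) ⟩
    raise (f (Fin.cast len (Fin.cast len-map u)))             ≡⟨ cong (raise ∘ f) (FinP.cast-trans len-map len u) ⟩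
    raise (f (Fin.cast (trans len-map len) u))                ∎
    where
    open ≡-Reasoning
    len-map = ListP.length-map raiseLabel ys

  blockRun : Fin (suc m) → List Label
  blockRun q = List.replicate (k (inject₁ q)) (Label.cone (inject₁ q)) ++ List.replicate (i q) (Label.iso q)

  tailRun : Fin m → List Tail.Label
  tailRun q = List.replicate (k (suc (inject₁ q))) (Tail.Label.cone (inject₁ q)) ++ List.replicate (i (suc q)) (Tail.Label.iso q)

  blockRun-suc : ∀ q → blockRun (suc q) ≡ List.map raiseLabel (tailRun q)
  blockRun-suc q = sym (trans (ListP.map-++ raiseLabel (List.replicate (k (suc (inject₁ q))) (Tail.Label.cone (inject₁ q))) _)
                              (cong₂ _++_ (ListP.map-replicate raiseLabel (k (suc (inject₁ q))) (Tail.Label.cone (inject₁ q)))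
                                          (ListP.map-replicate raiseLabel (i (suc q)) (Tail.Label.iso q))))

  concatMap-blockRun : ∀ {n} (f : Fin n → Fin m) →
    concatMap blockRun (tabulate (suc ∘ f)) ≡ List.map raiseLabel (concatMap tailRun (tabulate f))
  concatMap-blockRun {zero}  f = refl
  concatMap-blockRun {suc n} f = trans (cong₂ _++_ (blockRun-suc (f zero)) (concatMap-blockRun (f ∘ suc)))
                                       (sym (ListP.map-++ raiseLabel (tailRun (f zero)) _))

  labels-suc : Block.labels (suc m) k i ≡
    List.replicate (k zero) (Label.cone zero) ++ (List.replicate (i zero) (Label.iso zero) ++ List.map raiseLabel Tail.labels)
  labels-suc = begin
    ((K ++ I) ++ concatMap blockRun (tabulate suc)) ++ R
      ≡⟨ cong (λ z → ((K ++ I) ++ z) ++ R) (concatMap-blockRun (λ q → q)) ⟩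
    ((K ++ I) ++ List.map raiseLabel Cs) ++ R
      ≡⟨ ListP.++-assoc (K ++ I) (List.map raiseLabel Cs) R ⟩
    (K ++ I) ++ (List.map raiseLabel Cs ++ R)
      ≡⟨ ListP.++-assoc K I (List.map raiseLabel Cs ++ R) ⟩
    K ++ (I ++ (List.map raiseLabel Cs ++ R))
      ≡⟨ cong (λ z → K ++ (I ++ (List.map raiseLabel Cs ++ z)))
              (sym (ListP.map-replicate raiseLabel _ (Tail.Label.cone (fromℕ m)))) ⟩
    K ++ (I ++ (List.map raiseLabel Cs ++ List.map raiseLabel Rs))
      ≡⟨ cong (λ z → K ++ (I ++ z)) (sym (ListP.map-++ raiseLabel Cs Rs)) ⟩
    K ++ (I ++ List.map raiseLabel (Cs ++ Rs)) ∎
    where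
    open ≡-Reasoning
    K = List.replicate (k zero) (Label.cone zero)
    I = List.replicate (i zero) (Label.iso zero)
    R = List.replicate (k (fromℕ (suc m))) (Label.cone (fromℕ (suc m)))
    Cs = concatMap tailRun (tabulate (λ q → q))
    Rs = List.replicate (k (suc (fromℕ m))) (Tail.Label.cone (fromℕ m))

represents-labels : ∀ m k i → Represents {m} {k} {i} (Block.labels m k i) (order m k i) (labelling m k i)
represents-labels zero    k i =
  subst (λ xs → Represents xs (k zero ℕ.+ 0) (labelling zero k i))
        (ListP.++-identityʳ (List.replicate (k zero) (Block.Label.cone zero)))
        (represents-prependRun (k zero) (Block.Label.cone zero) [] 0 (λ ()) (refl , λ ()))
represents-labels (suc m) k i =
  subst (λ xs → Represents xs (order (suc m) k i) (labelling (suc m) k i)) (sym labels-suc)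
        (represents-prependRun (k zero) (Block.Label.cone zero) _ _ _
          (represents-prependRun (i zero) (Block.Label.iso zero) _ _ _
            (represents-raise (Block.labels m (k ∘ suc) (i ∘ suc)) _ (labelling m (k ∘ suc) (i ∘ suc))
                              (represents-labels m (k ∘ suc) (i ∘ suc)))))

sumℚ-ibSuffix : ∀ m (i : Fin m → ℕ) (b : Fin m → ℚ) p →
  sumℚ (λ s → if ⌊ toℕ p ℕ.≤? toℕ s ⌋ then ℕtoℚ (i s) * b s else 0ℚ) ≡ ibSuffix m i b p
sumℚ-ibSuffix zero    i b p       = refl
sumℚ-ibSuffix (suc m) i b zero    = cong (λ x → ℕtoℚ (i zero) * b zero + x) (sumℚ-ibSuffix m (i ∘ suc) (b ∘ suc) zero)
sumℚ-ibSuffix (suc m) i b (suc p) = trans (ℚP.+-identityˡ _)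
  (trans (sumℚ-cong (λ s → cong (λ e → if e then ℕtoℚ (i (suc s)) * b (suc s) else 0ℚ) (≤ᵇ-suc (toℕ p) (toℕ s))))
         (sumℚ-ibSuffix m (i ∘ suc) (b ∘ suc) p))

a≡α+ibSuffix : ∀ m k i α p → Block.a m k i α p ≡ α + ibSuffix m i (Block.b m k i) p
a≡α+ibSuffix m k i α p = cong (λ x → α + x) (sumℚ-ibSuffix m i (Block.b m k i) p)

module _ (m : ℕ) (k : Fin (suc m) → ℕ) (i : Fin m → ℕ) (α λ′ : ℚ) where

  open Block m k i using (Label; entry; b)

  shifted-entry : ∀ (x y : Label) same → (same ≡ true → x ≡ y) →
    entry α x y same - (if same then λ′ else 0ℚ) ≡
    1ℚ * entryPattern (λ p → α + ibSuffix m i b p) b (toBlockLabel x) (toBlockLabel y)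
    + (if same then diagonal b λ′ (toBlockLabel x) else 0ℚ)
  shifted-entry (Label.cone p) (Label.cone p′) true  _ =
    trans (cong (λ z → - z - λ′) (a≡α+ibSuffix m k i α _))
          (solve 2 (λ a l → :- a :- l := con 1ℚ :* (:- a) :+ (:- l)) refl
                 (α + ibSuffix m i b (if ⌊ toℕ p ℕ.≤? toℕ p′ ⌋ then p else p′)) λ′)
  shifted-entry (Label.cone p) (Label.cone p′) false _ =
    trans (cong (λ z → - z - 0ℚ) (a≡α+ibSuffix m k i α _))
          (solve 1 (λ a → :- a :- con 0ℚ := con 1ℚ :* (:- a) :+ con 0ℚ) refl
                 (α + ibSuffix m i b (if ⌊ toℕ p ℕ.≤? toℕ p′ ⌋ then p else p′)))
  shifted-entry (Label.cone p) (Label.iso q)   true  x≡y with () ← x≡y refl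
  shifted-entry (Label.cone p) (Label.iso q)   false _ =
    solve 1 (λ e → e :- con 0ℚ := con 1ℚ :* e :+ con 0ℚ) refl (if ⌊ toℕ q ℕ.<? toℕ p ⌋ then - b q else 0ℚ)
  shifted-entry (Label.iso q)  (Label.cone p)  true  x≡y with () ← x≡y refl
  shifted-entry (Label.iso q)  (Label.cone p)  false _ =
    solve 1 (λ e → e :- con 0ℚ := con 1ℚ :* e :+ con 0ℚ) refl (if ⌊ toℕ q ℕ.<? toℕ p ⌋ then - b q else 0ℚ)
  shifted-entry (Label.iso q)  (Label.iso q′)  true  x≡y with refl ← x≡y refl =
    solve 2 (λ b l → b :- l := con 1ℚ :* con 0ℚ :+ (b :- l)) refl (b q) λ′
  shifted-entry (Label.iso q)  (Label.iso q′)  false _ = solve 0 (con 0ℚ :- con 0ℚ := con 1ℚ :* con 0ℚ :+ con 0ℚ) refl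

det-cast : ∀ {n n′} (len : n ≡ n′) (A : Mat n′) → det n′ A ≡ det n (λ u v → A (Fin.cast len u) (Fin.cast len v))
det-cast {n} refl A = det-cong n (λ u v → sym (cong₂ A (FinP.cast-is-id refl u) (FinP.cast-is-id refl v)))

δ-cast : ∀ {n n′} (len : n ≡ n′) (u v : Fin n) → δ (Fin.cast len u) (Fin.cast len v) ≡ δ u v
δ-cast refl u v = cong₂ δ (FinP.cast-is-id refl u) (FinP.cast-is-id refl v)

δ-true : ∀ {n} (u v : Fin n) → δ u v ≡ true → u ≡ v
δ-true u v δ≡true = toWitness {a? = u ≟ v} (subst T (sym δ≡true) _)

det-patternMat-cast : ∀ {L : Set} (F : L → L → ℚ) (D : L → ℚ) {n n′} (len : n ≡ n′) lab w →
  det n′ (patternMat F D n′ lab w) ≡ det n (patternMat F D n (lab ∘ Fin.cast len) (w ∘ Fin.cast len))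
det-patternMat-cast F D len lab w = trans (det-cast len _) (det-cong _ λ u v →
  cong (λ e → w (Fin.cast len u) * F (lab (Fin.cast len u)) (lab (Fin.cast len v)) + (if e then D (lab (Fin.cast len u)) else 0ℚ))
       (δ-cast len u v))

det-patternMat-relabel : ∀ {L : Set} (F : L → L → ℚ) (D : L → ℚ) n {lab lab′ : Fin n → L} w →
  (∀ u → lab u ≡ lab′ u) → det n (patternMat F D n lab w) ≡ det n (patternMat F D n lab′ w)
det-patternMat-relabel F D n w lab≗lab′ = det-cong n λ u v →
  cong₂ (λ x y → w u * F x y + (if δ u v then D x else 0ℚ)) (lab≗lab′ u) (lab≗lab′ v)

det-shift-M : ∀ m k i α λ′ → det (Block.n m k i) (shift (Block.M m k i α) λ′) ≡
  det (order m k i) (charMat (λ p → α + ibSuffix m i (Block.b m k i) p) (Block.b m k i) λ′ _ (labelling m k i) (λ _ → 1ℚ))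
det-shift-M m k i α λ′ with represents-labels m k i
... | len , same = begin
  det (Block.n m k i) (shift (Block.M m k i α) λ′)
    ≡⟨ det-cong _ (λ u v → shifted-entry m k i α λ′ (label u) (label v) (δ u v)
                                         (λ δ≡true → cong label (δ-true u v δ≡true))) ⟩
  det (Block.n m k i) (charMat a b λ′ _ (toBlockLabel ∘ label) (λ _ → 1ℚ))
    ≡⟨ det-patternMat-relabel (entryPattern a b) (diagonal b λ′) _ (λ _ → 1ℚ) same ⟩
  det (Block.n m k i) (charMat a b λ′ _ (labelling m k i ∘ Fin.cast len) (λ _ → 1ℚ))
    ≡⟨ sym (det-patternMat-cast (entryPattern a b) (diagonal b λ′) len (labelling m k i) (λ _ → 1ℚ)) ⟩
  det (order m k i) (charMat a b λ′ _ (labelling m k i) (λ _ → 1ℚ)) ∎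
  where
  open ≡-Reasoning
  open Block m k i using (label; b)
  a = λ p → α + ibSuffix m i b p

invℕ-pos : ∀ n → 1 ≤ n → 0ℚ < invℕ n
invℕ-pos (suc n) _ = ℚP.positive⁻¹ (invℕ (suc n)) {{ℚP.normalize-pos 1 (suc n)}}

-- β_q counts at least the last cone block, since q < m.
b-pos : ∀ m k i → (∀ p → 1 ≤ k p) → ∀ q → 0ℚ < Block.b m k i q
b-pos m k i hk q = invℕ-pos (Block.β m k i q)
  (ℕP.≤-trans (hk (fromℕ m)) (ℕP.≤-trans (ℕP.≤-reflexive (sym last-counted))
                                          (sumℕ-≥ (λ p → if ⌊ toℕ q ℕ.<? toℕ p ⌋ then k p else 0) (fromℕ m))))
  where
  last-counted : (if ⌊ toℕ q ℕ.<? toℕ (fromℕ m) ⌋ then k (fromℕ m) else 0) ≡ k (fromℕ m)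
  last-counted = cong (λ e → if e then k (fromℕ m) else 0)
                      (trans (isYes≗does (toℕ q ℕ.<? toℕ (fromℕ m)))
                             (dec-true (toℕ q ℕ.<? toℕ (fromℕ m))
                                       (subst (toℕ q ℕ.<_) (sym (FinP.toℕ-fromℕ m)) (FinP.toℕ<n q))))

prodℚ-cong : ∀ {r} {f g : Fin r → ℚ} → (∀ q → f q ≡ g q) → prodℚ f ≡ prodℚ g
prodℚ-cong {zero}  f≗g = refl
prodℚ-cong {suc r} f≗g = cong₂ _*_ (f≗g zero) (prodℚ-cong (f≗g ∘ suc))

prodℚ-* : ∀ {r} (f g : Fin r → ℚ) → prodℚ (λ q → f q * g q) ≡ prodℚ f * prodℚ g
prodℚ-* {zero}  f g = refl
prodℚ-* {suc r} f g = trans (cong (f zero * g zero *_) (prodℚ-* (f ∘ suc) (g ∘ suc)))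
  (solve 4 (λ a b c d → (a :* b) :* (c :* d) := (a :* c) :* (b :* d)) refl (f zero) (g zero) (prodℚ (f ∘ suc)) (prodℚ (g ∘ suc)))

^ℚ-∸-bit : ∀ x n e → 1 ≤ n → x ^ℚ (n ∸ bit e) ≡ x ^ℚ (n ∸ 1) * (if e then 1ℚ else x)
^ℚ-∸-bit x (suc n) true  _ = sym (ℚP.*-identityʳ _)
^ℚ-∸-bit x (suc n) false _ = ℚP.*-comm x (x ^ℚ n)

module _ (m : ℕ) (k : Fin (suc m) → ℕ) (i : Fin m → ℕ) where

  open Block m k i using (b; prodF; prodPow; zeros; rhs)

  prodF≡prodℚ : ∀ {r} (f : Fin r → ℚ) → prodF f ≡ prodℚ f
  prodF≡prodℚ {zero}  f = refl
  prodF≡prodℚ {suc r} f = cong (f zero *_) (prodF≡prodℚ (f ∘ suc))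

  zeros≡replicate : ∀ {r} → zeros {r} ≡ replicate r false
  zeros≡replicate {zero}  = refl
  zeros≡replicate {suc r} = cong (false ∷_) zeros≡replicate

  prodPow≡ : ∀ λ′ ε → (∀ q → 1 ≤ i q) →
    prodPow λ′ ε ≡ prodℚ (λ q → (b q - λ′) ^ℚ (i q ∸ 1)) * basis b λ′ ε
  prodPow≡ λ′ ε hi = begin
    prodF (λ q → (b q - λ′) ^ℚ (i q ∸ bit (lookup ε q)))
      ≡⟨ prodF≡prodℚ (λ q → (b q - λ′) ^ℚ (i q ∸ bit (lookup ε q))) ⟩
    prodℚ (λ q → (b q - λ′) ^ℚ (i q ∸ bit (lookup ε q)))
      ≡⟨ prodℚ-cong (λ q → ^ℚ-∸-bit (b q - λ′) (i q) (lookup ε q) (hi q)) ⟩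
    prodℚ (λ q → (b q - λ′) ^ℚ (i q ∸ 1) * (if lookup ε q then 1ℚ else b q - λ′))
      ≡⟨ prodℚ-* (λ q → (b q - λ′) ^ℚ (i q ∸ 1)) (λ q → if lookup ε q then 1ℚ else b q - λ′) ⟩
    prodℚ (λ q → (b q - λ′) ^ℚ (i q ∸ 1)) * basis b λ′ ε ∎
    where open ≡-Reasoning

  rhs≡ : ∀ γ c λ′ → (∀ q → 1 ≤ i q) →
    rhs γ c λ′ ≡ prefactor m k i b λ′ * ((- γ - λ′) * basis b λ′ (replicate m false) - expand m b λ′ c)
  rhs≡ γ c λ′ hi = begin
    X * ((- γ - λ′) * prodPow λ′ zeros - sumBoolVec m (λ ε → c ε * prodPow λ′ ε))
      ≡⟨ cong₂ (λ u v → X * ((- γ - λ′) * u - v))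
               (trans (prodPow≡ λ′ zeros hi) (cong (λ ε → Q * basis b λ′ ε) zeros≡replicate))
               (sumBoolVec-cong m (λ ε → trans (cong (c ε *_) (prodPow≡ λ′ ε hi))
                                               (solve 3 (λ c q e → c :* (q :* e) := q :* (c :* e)) refl (c ε) Q (basis b λ′ ε)))) ⟩
    X * ((- γ - λ′) * (Q * P) - sumBoolVec m (λ ε → Q * (c ε * basis b λ′ ε)))
      ≡⟨ cong (λ v → X * ((- γ - λ′) * (Q * P) - v)) (sumBoolVec-scale m (λ ε → c ε * basis b λ′ ε) Q) ⟩
    X * ((- γ - λ′) * (Q * P) - Q * expand m b λ′ c)
      ≡⟨ solve 6 (λ x q g l p e → x :* ((:- g :- l) :* (q :* p) :- q :* e) := x :* q :* ((:- g :- l) :* p :- e)) refl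
               X Q γ λ′ P (expand m b λ′ c) ⟩
    X * Q * ((- γ - λ′) * P - expand m b λ′ c) ∎
    where
    open ≡-Reasoning
    X = (- λ′) ^ℚ (sumℕ k ∸ 1)
    Q = prodℚ (λ q → (b q - λ′) ^ℚ (i q ∸ 1))
    P = basis b λ′ (replicate m false)

maxOver : ∀ m → (Vec Bool m → ℚ) → ℚ
maxOver zero    f = f []
maxOver (suc m) f = maxOver m (f ∘ (false ∷_)) ⊔ maxOver m (f ∘ (true ∷_))

maxOver-≥ : ∀ m (f : Vec Bool m → ℚ) ε → f ε ℚ.≤ maxOver m f
maxOver-≥ zero    f []          = ℚP.≤-refl
maxOver-≥ (suc m) f (false ∷ ε) = ℚP.p≤q⇒p≤q⊔r _ (maxOver-≥ m (f ∘ (false ∷_)) ε)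
maxOver-≥ (suc m) f (true ∷ ε)  = ℚP.p≤q⇒p≤r⊔q (maxOver m (f ∘ (false ∷_))) (maxOver-≥ m (f ∘ (true ∷_)) ε)

affine-pos : ∀ a e w (0<w : 0ℚ < w) → (- e) * (1/ w) {{ℚP.pos⇒nonZero w {{positive 0<w}}}} < a → 0ℚ < a * w + e
affine-pos a e w 0<w root<a = subst (_< a * w + e) root-cancels (ℚP.+-monoˡ-< e (ℚP.*-monoˡ-<-pos w {{positive 0<w}} root<a))
  where
  instance _ = ℚP.pos⇒nonZero w {{positive 0<w}}
  root-cancels : (- e) * 1/ w * w + e ≡ 0ℚ
  root-cancels = begin
    (- e) * 1/ w * w + e    ≡⟨ cong (_+ e) (ℚP.*-assoc (- e) (1/ w) w) ⟩
    (- e) * (1/ w * w) + e  ≡⟨ cong (λ x → (- e) * x + e) (ℚP.*-inverseˡ w) ⟩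
    (- e) * 1ℚ + e          ≡⟨ cong (_+ e) (ℚP.*-identityʳ (- e)) ⟩
    (- e) + e               ≡⟨ ℚP.+-inverseˡ e ⟩
    0ℚ                      ∎
    where open ≡-Reasoning

eventually-pos : ∀ m (w e : Vec Bool m → ℚ) → (∀ ε → 0ℚ < w ε) →
  ∃[ A ] ∀ a → A < a → ∀ ε → 0ℚ < a * w ε + e ε
eventually-pos m w e 0<w =
  maxOver m root , λ a max<a ε → affine-pos a (e ε) (w ε) (0<w ε) (ℚP.≤-<-trans (maxOver-≥ m root ε) max<a)
  where
  root : Vec Bool m → ℚ
  root ε = (- e ε) * (1/ w ε) {{ℚP.pos⇒nonZero (w ε) {{positive (0<w ε)}}}}

-- With h ε = a W_ε + E_ε, the choice γ = h₀ / 2 and c = h - γ [ε = 0] keeps every coefficient positive.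
positive-expansion : ∀ m k i b a → (∀ ε → 0ℚ < a * coeffW m k i b ε + coeffE m k i b ε) →
  Σ ℚ λ γ → Σ (Vec Bool m → ℚ) λ c → 0ℚ < γ × (∀ ε → 0ℚ < c ε) ×
    (∀ λ′ → - λ′ * polyG m k i b λ′ - a * polyW m k i b λ′
            ≡ (- γ - λ′) * basis b λ′ (replicate m false) - expand m b λ′ c)
positive-expansion m k i b a 0<h = γ , c , 0<γ , 0<c , shape
  where
  h : Vec Bool m → ℚ
  h ε = a * coeffW m k i b ε + coeffE m k i b ε
  γ = h (replicate m false) * ½
  c : Vec Bool m → ℚ
  c ε = h ε + - γ * isFalses m ε
  0<γ : 0ℚ < γ
  0<γ = pos*pos (0<h (replicate m false)) (ℚP.positive⁻¹ ½)
  0<c : ∀ ε → 0ℚ < c ε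
  0<c ε with isFalses-cases m ε
  ... | inj₁ is0          = subst (0ℚ <_) c≡h (0<h ε)
    where
    c≡h : h ε ≡ c ε
    c≡h = sym (trans (cong (λ d → h ε + - γ * d) is0) (solve 2 (λ x g → x :+ (:- g) :* con 0ℚ := x) refl (h ε) γ))
  ... | inj₂ (is1 , refl) = subst (0ℚ <_) c≡γ 0<γ
    where
    c≡γ : γ ≡ c (replicate m false)
    c≡γ = sym (trans (cong (λ d → h (replicate m false) + - γ * d) is1)
                     (solve 1 (λ x → x :+ (:- (x :* con ½)) :* con 1ℚ := x :* con ½) refl (h (replicate m false))))
  shape : ∀ λ′ → - λ′ * polyG m k i b λ′ - a * polyW m k i b λ′
                 ≡ (- γ - λ′) * basis b λ′ (replicate m false) - expand m b λ′ c
  shape λ′ = sym (begin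
    (- γ - λ′) * P - expand m b λ′ c
      ≡⟨ cong (λ x → (- γ - λ′) * P - x) expand-c ⟩
    (- γ - λ′) * P - ((λ′ * (G - P) + a * W) + - γ * P)
      ≡⟨ solve 6 (λ g l p G a W → (:- g :- l) :* p :- ((l :* (G :- p) :+ a :* W) :+ (:- g) :* p) := :- l :* G :- a :* W) refl
               γ λ′ P G a W ⟩
    - λ′ * G - a * W ∎)
    where
    open ≡-Reasoning
    G = polyG m k i b λ′
    W = polyW m k i b λ′
    P = basis b λ′ (replicate m false)
    expand-h : expand m b λ′ h ≡ λ′ * (G - P) + a * W
    expand-h = begin
      expand m b λ′ h
        ≡⟨ expand-cong m b λ′ (λ ε → ℚP.+-comm (a * coeffW m k i b ε) (coeffE m k i b ε)) ⟩
      expand m b λ′ (λ ε → coeffE m k i b ε + a * coeffW m k i b ε)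
        ≡⟨ expand-linear m b λ′ (coeffE m k i b) (coeffW m k i b) a ⟩
      expand m b λ′ (coeffE m k i b) + a * expand m b λ′ (coeffW m k i b)
        ≡⟨ cong₂ (λ x y → x + a * y) (expand-coeffE m k i b λ′) (expand-coeffW m k i b λ′) ⟩
      λ′ * (G - P) + a * W ∎
    expand-c : expand m b λ′ c ≡ (λ′ * (G - P) + a * W) + - γ * P
    expand-c = trans (expand-linear m b λ′ h (isFalses m) (- γ))
                     (cong₂ (λ x y → x + - γ * y) expand-h (expand-isFalses m b λ′))

det-shift-M≡rhs : ∀ m k i α₁ γ c → (∀ p → 1 ≤ k p) → (∀ q → 1 ≤ i q) →
  (∀ λ′ → - λ′ * polyG m k i (Block.b m k i) λ′
          - (α₁ + ibSuffix m i (Block.b m k i) zero) * polyW m k i (Block.b m k i) λ′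
          ≡ (- γ - λ′) * basis (Block.b m k i) λ′ (replicate m false) - expand m (Block.b m k i) λ′ c) →
  ∀ λ′ → det (Block.n m k i) (shift (Block.M m k i α₁) λ′) ≡ Block.rhs m k i γ c λ′
det-shift-M≡rhs m k i α₁ γ c hk hi shape λ′ = begin
  det (Block.n m k i) (shift (Block.M m k i α₁) λ′)
    ≡⟨ det-shift-M m k i α₁ λ′ ⟩
  det (order m k i) (charMat (λ p → α₁ + ibSuffix m i b p) b λ′ _ (labelling m k i) (λ _ → 1ℚ))
    ≡⟨ det-charMat-threshold m k i b hk hi α₁ λ′ ⟩
  prefactor m k i b λ′ * (- λ′ * polyG m k i b λ′ - (α₁ + ibSuffix m i b zero) * polyW m k i b λ′)
    ≡⟨ cong (prefactor m k i b λ′ *_) (shape λ′) ⟩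
  prefactor m k i b λ′ * ((- γ - λ′) * basis b λ′ (replicate m false) - expand m b λ′ c)
    ≡⟨ sym (rhs≡ m k i γ c λ′ hi) ⟩
  Block.rhs m k i γ c λ′ ∎
  where
  open ≡-Reasoning
  b = Block.b m k i

proposition3p1 : (m : ℕ) (k : Fin (suc m) → ℕ) (i : Fin m → ℕ) →
    (∀ p → 1 ≤ k p) → (∀ q → 1 ≤ i q) →
    ∃[ A ] ∀ (α₁ : ℚ) → 0ℚ < α₁ → A < α₁ →
      Σ ℚ (λ γ → Σ (Vec Bool m → ℚ) (λ c →
        (0ℚ < γ) × (∀ ε → 0ℚ < c ε) ×
        (∀ (λ' : ℚ) → det (Block.n m k i) (shift (Block.M m k i α₁) λ') ≡ Block.rhs m k i γ c λ')))
proposition3p1 m k i hk hi = A - c₀ , λ α₁ _ A-c₀<α₁ →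
  let γ , c , 0<γ , 0<c , shape = positive-expansion m k i b (α₁ + c₀) (large (α₁ + c₀) (shift-bound A-c₀<α₁))
  in  γ , c , 0<γ , 0<c , det-shift-M≡rhs m k i α₁ γ c hk hi shape
  where
  b = Block.b m k i
  c₀ = ibSuffix m i b zero
  bound : ∃[ A ] ∀ a → A < a → ∀ ε → 0ℚ < a * coeffW m k i b ε + coeffE m k i b ε
  bound = eventually-pos m (coeffW m k i b) (coeffE m k i b) (coeffW-pos m k i b hk hi (b-pos m k i hk))
  A = proj₁ bound
  large = proj₂ bound
  shift-bound : ∀ {α₁} → A - c₀ < α₁ → A < α₁ + c₀
  shift-bound {α₁} A-c₀<α₁ =
    subst (_< α₁ + c₀) (solve 2 (λ a c → a :- c :+ c := a) refl A c₀) (ℚP.+-monoˡ-< c₀ A-c₀<α₁)
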